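{- For every integer $n\ge1$, $\eta_1(\mathbb{Z}_4^n)\le 2^n+3\cdot 2^{n/2}$. In particular, $\eta_1(\mathbb{Z}_4^n)=(1+o(1))2^n$ as $n\to\infty$.
   Context: For a finite abelian group $G$, a subset $A$ is a $1$-difference basis of $G$ if every $x\in G$ can be written as $a-b$ with $a,b\in A$; $\eta_1(G)$ is the minimum size of such a set. $\mathbb{Z}_m$ is the cyclic group of order $m$. -}

module Defs where

open import Data.Nat using (ℕ; _+_; _*_; _∸_; _^_; _≤_)
open import Data.Nat.DivMod using (_mod_)
open import Data.Fin using (Fin; toℕ)
open import Data.Vec using (Vec; zipWith)
open import Data.List using (List; length)
open import Data.List.Membership.Propositional using (_∈_)
open import Data.List.Relation.Unary.Unique.Propositional using (Unique)
open import Data.Product using (Σ; ∃; ∃-syntax; _×_)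
open import Relation.Binary.PropositionalEquality using (_≡_)

Z4 : Set
Z4 = Fin 4

_-₄_ : Z4 → Z4 → Z4
a -₄ b = (toℕ a + (4 ∸ toℕ b)) mod 4

Z4^ : ℕ → Set
Z4^ n = Vec Z4 n

_-ᵥ_ : ∀ {n} → Z4^ n → Z4^ n → Z4^ n
x -ᵥ y = zipWith _-₄_ x y

-- A (finite set, given as a duplicate-free list) A is a 1-difference basis
-- of Z_4^n if every x is a - b with a, b ∈ A.
IsDiffBasis : (n : ℕ) → List (Z4^ n) → Set
IsDiffBasis n A = ∀ (x : Z4^ n) → ∃[ a ] ∃[ b ] (a ∈ A × b ∈ A × x ≡ a -ᵥ b)

-- m ≤ 2^n + 3·2^{n/2} (real inequality) for natural m, stated without reals:
-- equivalent to (m ∸ 2^n)^2 ≤ 9·2^n.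
BelowBound : ℕ → ℕ → Set
BelowBound n m = (m ∸ 2 ^ n) * (m ∸ 2 ^ n) ≤ 9 * 2 ^ n

{-# OPTIONS --safe #-}
-- Write x ∈ ℤ₄ⁿ as a + 2p with a, p ∈ 𝔽₂ⁿ. Then (a + 2p) − (b + 2q) = (a ⊕ b) + 2(b ∧ (a ⊕ b) ⊕ p ⊕ q),
-- so the differences of the graph {a + 2 f(a)} of a map f : 𝔽₂ⁿ → 𝔽₂ⁿ contain every x with low
-- part u ≠ 0 as soon as b ↦ b ∧ u ⊕ f(b ⊕ u) ⊕ f(b) is onto for each u ≠ 0. Identifying 𝔽₂ⁿ with
-- the field 𝔽_{2ⁿ}, take f quadratic with polar form √(ab) ⊕ a ∧ b: the map becomes b ↦ f(u) ⊕ √(bu),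
-- a bijection. The remaining elements 2p are differences of 2(w, 0) and 2(0, w′) with w, w′ ranging
-- over 𝔽₂^⌊n/2⌋ and 𝔽₂^⌈n/2⌉, so the basis has at most 2ⁿ + 2^⌊n/2⌋ + 2^⌈n/2⌉ ≤ 2ⁿ + 3·2^(n/2)
-- elements. The field exists since 𝔽₂ has irreducible polynomials of every degree m: unique
-- factorisation yields Gauss's formula ∑_{d ∣ m} d·I_d = 2^m, which forces I_m > 0.
module Submission where

open import Defs

open import Algebra.Bundles using (CommutativeSemiring; CommutativeRing; RawRing)
import Algebra.Properties.Monoid.Divisibility as MonoidDivisibility
open import Algebra.Solver.Ring.AlmostCommutativeRing
  using (_-Raw-AlmostCommutative⟶_; fromCommutativeSemiring)
import Algebra.Solver.Ring as RingSolver
open import Algebra.Structures using (IsCommutativeMonoid)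
open import Algebra.Structures.Biased using (isCommutativeSemiringˡ)
open import Data.Bool using (Bool; true; false; _xor_; _∧_; not)
open import Data.Bool.Properties as Boolₚ using (xor-same; xor-∧-commutativeRing)
open import Data.Fin using (zero; suc)
import Data.Fin as Fin
open import Data.List
  using (List; []; _∷_; [_]; _++_; map; length; filter; cartesianProductWith; upTo; deduplicate)
open import Data.List.Membership.Propositional using (_∈_; lose; find)
import Data.List.Membership.DecPropositional as DecMembership
open import Data.List.Membership.Propositional.Properties
  using (∈-map⁺; ∈-map⁻; ∈-++⁺ˡ; ∈-++⁺ʳ; ∈-++⁻; ∈-filter⁺; ∈-filter⁻; ∈-cartesianProductWith⁺;
         ∈-deduplicate⁺; ∈-upTo⁻)
open import Data.List.Membership.Propositional.Properties.WithK using (unique∧set⇒bag)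
open import Data.List.Properties
  using (length-++; length-map; length-filter; length-deduplicate; map-upTo; upTo-∷ʳ)
import Data.List.Properties as Listₚ
open import Data.List.Relation.Binary.BagAndSetEquality using (∼bag⇒↭)
open import Data.List.Relation.Binary.Permutation.Propositional.Properties using (↭-length)
open import Data.List.Relation.Binary.Subset.Propositional using (_⊆_)
open import Data.List.Relation.Unary.All using ([]; _∷_)
open import Data.List.Relation.Unary.All.Properties using (¬Any⇒All¬)
open import Data.List.Relation.Unary.AllPairs using ([]; _∷_)
open import Data.List.Relation.Unary.Any using (here; there; any?; satisfied)
open import Data.List.Relation.Unary.Unique.DecPropositional.Properties using (deduplicate-!)
open import Data.List.Relation.Unary.Unique.Propositional using (Unique)
open import Data.List.Relation.Unary.Unique.Propositional.Properties
  using (map⁺; ++⁺; filter⁺; cartesianProductWith⁺)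
open import Data.Maybe using (Maybe; just; nothing)
open import Data.Nat
  using (ℕ; zero; suc; pred; _+_; _*_; _∸_; _^_; _≤_; _<_; _≥_; z≤n; s≤s; _≤?_; _≟_; ⌊_/2⌋; ⌈_/2⌉)
open import Data.Nat.Induction using (<-wellFounded)
open import Data.Nat.Properties
  using (≤-refl; ≤-trans; ≤-antisym; ≤-reflexive; ≤-pred; <-trans; <-≤-trans; ≤-<-trans; <-irrefl;
         <⇒≤; <⇒≱; ≰⇒>; m≤n⇒m<n∨m≡n; m<n⇒m<1+n; m≤n⇒m≤1+n; n≤1+n; m≤m+n; m≤n+m; m<n+m;
         +-assoc; +-comm; +-identityʳ; +-cancelˡ-≡; +-mono-≤; +-monoʳ-≤;
         *-zeroʳ; *-identityʳ; *-suc; *-distribˡ-+; *-mono-≤; *-monoˡ-≤; *-monoʳ-≤;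
         +-∸-assoc; n∸n≡0; m∸n+n≡m; m+n∸n≡m; m+n∸m≡n; ∸-monoˡ-≤;
         m^n>0; ^-distribˡ-+-*; ^-monoʳ-≤;
         ⌊n/2⌋≤n; ⌊n/2⌋≤⌈n/2⌉; ⌊n/2⌋+⌈n/2⌉≡n; ⌊n/2⌋-mono; n≡⌊n+n/2⌋; +-commutativeSemigroup;
         module ≤-Reasoning)
open import Algebra.Properties.CommutativeSemigroup +-commutativeSemigroup
  using () renaming (interchange to +-+-interchange)
open import Data.Nat.Solver using (module +-*-Solver)
open import Data.Product using (∃-syntax; Σ-syntax; _×_; _,_; proj₁; proj₂)
open import Data.Sum using (_⊎_; inj₁; inj₂; reduce)
open import Data.Vec
  using (Vec; []; _∷_; zipWith; replicate; toList; fromList; splitAt) renaming (_++_ to _++ᵛ_)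
import Data.Vec as Vec
open import Data.Vec.Properties
  using (toList∘fromList; length-toList; toList-injective; ∷-injective;
         zipWith-assoc; zipWith-comm; zipWith-idem; zipWith-identityˡ; zipWith-identityʳ;
         zipWith-distribʳ; zipWith-zeroˡ)
import Data.Vec.Properties as Vecₚ
open import Data.Vec.Relation.Binary.Equality.Cast using (cast-is-id)
open import Function using (id; _∘_; _⇔_; mk⇔; Equivalence)
open import Function.Definitions using (Injective)
open import Induction.WellFounded using (Acc; acc)
open import Level using (0ℓ)
open import Relation.Binary.Definitions using (DecidableEquality)
open import Relation.Binary.PropositionalEquality
  using (_≡_; _≢_; refl; sym; trans; cong; cong₂; subst; isEquivalence; module ≡-Reasoning)
open import Relation.Nullary using (¬_; Dec; yes; no; contradiction; _×-dec_)
open import Relation.Unary using (Decidable)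

𝔽₂ : RawRing 0ℓ 0ℓ
𝔽₂ = record
  { Carrier = Bool ; _≈_ = _≡_ ; _+_ = _xor_ ; _*_ = _∧_ ; -_ = id ; 0# = false ; 1# = true }

HasCharacteristicTwo : CommutativeSemiring 0ℓ 0ℓ → Set
HasCharacteristicTwo R = ∀ x → x +ᴿ x ≈ 0#
  where open CommutativeSemiring R using (_≈_; 0#) renaming (_+_ to _+ᴿ_)

-- In characteristic two negation is the identity, so such a semiring is a ring whose
-- equations can be decided with coefficients computed in 𝔽₂.
module CharacteristicTwoSolver (R : CommutativeSemiring 0ℓ 0ℓ) (x+x≈0 : HasCharacteristicTwo R) where

  private
    module R = CommutativeSemiring R
    open R using (Carrier; _≈_; 0#; 1#) renaming (_+_ to _+ᴿ_; _*_ to _*ᴿ_)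

    ι : Bool → Carrier
    ι false = 0#
    ι true  = 1#

    ι-homomorphism : 𝔽₂ -Raw-AlmostCommutative⟶ fromCommutativeSemiring R
    ι-homomorphism = record
      { ⟦_⟧    = ι
      ; +-homo = +-homo
      ; *-homo = *-homo
      ; -‿homo = λ _ → R.refl
      ; 0-homo = R.refl
      ; 1-homo = R.refl
      }
      where
      +-homo : ∀ a b → ι (a xor b) ≈ ι a +ᴿ ι b
      +-homo false b     = R.sym (R.+-identityˡ (ι b))
      +-homo true  false = R.sym (R.+-identityʳ 1#)
      +-homo true  true  = R.sym (x+x≈0 1#)
      *-homo : ∀ a b → ι (a ∧ b) ≈ ι a *ᴿ ι b
      *-homo false b = R.sym (R.zeroˡ (ι b))
      *-homo true  b = R.sym (R.*-identityˡ (ι b))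

    ι-≟ : ∀ a b → Maybe (ι a ≈ ι b)
    ι-≟ a b with a Boolₚ.≟ b
    ... | yes refl = just R.refl
    ... | no _     = nothing

  open RingSolver 𝔽₂ (fromCommutativeSemiring R) ι-homomorphism ι-≟ public
    using (solve; _:=_; _:+_; _:*_; con)

Bits : ℕ → Set
Bits n = Vec Bool n

infixl 6 _⊕_
infixl 7 _∧ᵛ_

_⊕_ : ∀ {n} → Bits n → Bits n → Bits n
_⊕_ = zipWith _xor_

_∧ᵛ_ : ∀ {n} → Bits n → Bits n → Bits n
_∧ᵛ_ = zipWith _∧_

0ᵛ : ∀ {n} → Bits n
0ᵛ {n} = replicate n false

pointwise-isCommutativeMonoid : ∀ {A : Set} {n} {f : A → A → A} {e} →
  IsCommutativeMonoid _≡_ f e → IsCommutativeMonoid _≡_ (zipWith {n = n} f) (replicate n e)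
pointwise-isCommutativeMonoid M = record
  { isMonoid = record
    { isSemigroup = record
      { isMagma = record { isEquivalence = isEquivalence ; ∙-cong = cong₂ _ }
      ; assoc   = zipWith-assoc M.assoc
      }
    ; identity = zipWith-identityˡ M.identityˡ , zipWith-identityʳ M.identityʳ
    }
  ; comm = zipWith-comm M.comm
  }
  where module M = IsCommutativeMonoid M

bits-commutativeSemiring : ℕ → CommutativeSemiring 0ℓ 0ℓ
bits-commutativeSemiring n = record
  { _+_ = _⊕_
  ; _*_ = _∧ᵛ_
  ; 0#  = 0ᵛ
  ; 1#  = replicate n true
  ; isCommutativeSemiring = isCommutativeSemiringˡ record
    { +-isCommutativeMonoid = pointwise-isCommutativeMonoid 𝔹.+-isCommutativeMonoid
    ; *-isCommutativeMonoid = pointwise-isCommutativeMonoid 𝔹.*-isCommutativeMonoid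
    ; distribʳ              = zipWith-distribʳ 𝔹.distribʳ
    ; zeroˡ                 = zipWith-zeroˡ 𝔹.zeroˡ
    }
  }
  where module 𝔹 = CommutativeRing xor-∧-commutativeRing

⊕-self : ∀ {n} (x : Bits n) → x ⊕ x ≡ 0ᵛ
⊕-self []      = refl
⊕-self (a ∷ x) = cong₂ _∷_ (xor-same a) (⊕-self x)

module BitsSolver {n} = CharacteristicTwoSolver (bits-commutativeSemiring n) ⊕-self

⊕-identityˡ : ∀ {n} (v : Bits n) → 0ᵛ ⊕ v ≡ v
⊕-identityˡ = zipWith-identityˡ Boolₚ.xor-identityˡ

⊕≡0ᵛ⇒≡ : ∀ {n} {v w : Bits n} → v ⊕ w ≡ 0ᵛ → v ≡ w
⊕≡0ᵛ⇒≡ {n} {v} {w} eq = begin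
  v             ≡⟨ solve 2 (λ v w → v := (v :+ w) :+ w) refl v w ⟩
  (v ⊕ w) ⊕ w   ≡⟨ cong (_⊕ w) eq ⟩
  0ᵛ ⊕ w        ≡⟨ ⊕-identityˡ w ⟩
  w             ∎
  where
  open ≡-Reasoning
  open BitsSolver {n}

∧ᵛ-idem : ∀ {n} (v : Bits n) → v ∧ᵛ v ≡ v
∧ᵛ-idem = zipWith-idem Boolₚ.∧-idem

vectors : ∀ n → List (Bits n)
vectors zero    = [ [] ]
vectors (suc n) = cartesianProductWith _∷_ (false ∷ true ∷ []) (vectors n)

∈-vectors : ∀ {n} (v : Bits n) → v ∈ vectors n
∈-vectors []      = here refl
∈-vectors (b ∷ v) = ∈-cartesianProductWith⁺ _∷_ (∈-bools b) (∈-vectors v)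
  where
  ∈-bools : ∀ b → b ∈ false ∷ true ∷ []
  ∈-bools false = here refl
  ∈-bools true  = there (here refl)

vectors-unique : ∀ n → Unique (vectors n)
vectors-unique zero    = [] ∷ []
vectors-unique (suc n) =
  cartesianProductWith⁺ _∷_ ∷-injective (((λ ()) ∷ []) ∷ [] ∷ []) (vectors-unique n)

length-vectors : ∀ n → length (vectors n) ≡ 2 ^ n
length-vectors zero    = refl
length-vectors (suc n) = begin
  length (map (false ∷_) vs ++ map (true ∷_) vs ++ [])
    ≡⟨ length-++ (map (false ∷_) vs) ⟩
  length (map (false ∷_) vs) + length (map (true ∷_) vs ++ [])
    ≡⟨ cong₂ _+_ (length-map _ vs) (trans (length-++ (map (true ∷_) vs)) (cong (_+ 0) (length-map _ vs))) ⟩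
  length vs + (length vs + 0)
    ≡⟨ cong (λ m → m + (m + 0)) (length-vectors n) ⟩
  2 ^ suc n ∎
  where
  open ≡-Reasoning
  vs = vectors n

_≟ᵛ_ : ∀ {n} → DecidableEquality (Bits n)
_≟ᵛ_ = Vecₚ.≡-dec Boolₚ._≟_

unique-set-equal⇒length≡ : ∀ {A : Set} {xs ys : List A} → Unique xs → Unique ys →
  (∀ {x} → x ∈ xs ⇔ x ∈ ys) → length xs ≡ length ys
unique-set-equal⇒length≡ !xs !ys xs≈ys = ↭-length (∼bag⇒↭ (unique∧set⇒bag !xs !ys xs≈ys))

module _ {A : Set} (_≟_ : DecidableEquality A) where
  open DecMembership _≟_ using (_∈?_)

  unique-⊆⇒length≤ : ∀ {xs ys : List A} → Unique xs → Unique ys → xs ⊆ ys → length xs ≤ length ys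
  unique-⊆⇒length≤ {xs} {ys} !xs !ys xs⊆ys = ≤-trans
    (≤-reflexive (unique-set-equal⇒length≡ !xs (filter⁺ (_∈? xs) !ys)
      (mk⇔ (λ x∈xs → ∈-filter⁺ (_∈? xs) (xs⊆ys x∈xs) x∈xs) (λ x∈ → proj₂ (∈-filter⁻ (_∈? xs) {xs = ys} x∈)))))
    (length-filter (_∈? xs) ys)

  injective⇒surjective : ∀ {xs : List A} → Unique xs → (∀ x → x ∈ xs) →
    (f : A → A) → Injective _≡_ _≡_ f → ∀ y → ∃[ x ] f x ≡ y
  injective⇒surjective {xs} !xs complete f f-injective y with y ∈? map f xs
  ... | yes y∈fxs = let x , _ , y≡fx = ∈-map⁻ f y∈fxs in x , sym y≡fx
  ... | no  y∉fxs = contradiction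
    (unique-⊆⇒length≤ (¬Any⇒All¬ (map f xs) y∉fxs ∷ map⁺ f-injective !xs) !xs (λ {z} _ → complete z))
    (λ fxs<xs → <-irrefl refl (subst (λ m → suc m ≤ length xs) (length-map f xs) fxs<xs))

bits-injective⇒surjective : ∀ {n} (f : Bits n → Bits n) → Injective _≡_ _≡_ f → ∀ y → ∃[ x ] f x ≡ y
bits-injective⇒surjective {n} = injective⇒surjective _≟ᵛ_ (vectors-unique n) ∈-vectors

∑ : ∀ {A : Set} → List A → (A → ℕ) → ℕ
∑ []       f = 0
∑ (x ∷ xs) f = f x + ∑ xs f

syntax ∑ xs (λ x → e) = ∑[ x ∈ xs ] e

𝟙 : ∀ {P : Set} → Dec P → ℕ
𝟙 (yes _) = 1
𝟙 (no _)  = 0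

module _ {A : Set} where

  ∑-++ : ∀ (xs ys : List A) f → ∑ (xs ++ ys) f ≡ ∑ xs f + ∑ ys f
  ∑-++ []       ys f = refl
  ∑-++ (x ∷ xs) ys f = trans (cong (f x +_) (∑-++ xs ys f)) (sym (+-assoc (f x) _ _))

  ∑-cong : ∀ {xs : List A} {f g} → (∀ {x} → x ∈ xs → f x ≡ g x) → ∑ xs f ≡ ∑ xs g
  ∑-cong {[]}     f≗g = refl
  ∑-cong {x ∷ xs} f≗g = cong₂ _+_ (f≗g (here refl)) (∑-cong (f≗g ∘ there))

  ∑-mono-≤ : ∀ {xs : List A} {f g} → (∀ {x} → x ∈ xs → f x ≤ g x) → ∑ xs f ≤ ∑ xs g
  ∑-mono-≤ {[]}     f≤g = z≤n
  ∑-mono-≤ {x ∷ xs} f≤g = +-mono-≤ (f≤g (here refl)) (∑-mono-≤ (f≤g ∘ there))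

  ∑-zero : ∀ (xs : List A) → ∑[ x ∈ xs ] 0 ≡ 0
  ∑-zero []       = refl
  ∑-zero (x ∷ xs) = ∑-zero xs

  ∑-distrib-+ : ∀ (xs : List A) f g → ∑[ x ∈ xs ] (f x + g x) ≡ ∑ xs f + ∑ xs g
  ∑-distrib-+ []       f g = refl
  ∑-distrib-+ (x ∷ xs) f g = trans (cong (f x + g x +_) (∑-distrib-+ xs f g))
    (+-+-interchange (f x) (g x) _ _)

  ∑-distribˡ-* : ∀ c (xs : List A) f → ∑[ x ∈ xs ] (c * f x) ≡ c * ∑ xs f
  ∑-distribˡ-* c []       f = sym (*-zeroʳ c)
  ∑-distribˡ-* c (x ∷ xs) f = trans (cong (c * f x +_) (∑-distribˡ-* c xs f)) (sym (*-distribˡ-+ c (f x) _))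

  ∑-const : ∀ (xs : List A) c → ∑[ x ∈ xs ] c ≡ c * length xs
  ∑-const []       c = sym (*-zeroʳ c)
  ∑-const (x ∷ xs) c = trans (cong (c +_) (∑-const xs c)) (sym (*-suc c (length xs)))

  ∑𝟙≡length-filter : ∀ {P : A → Set} (P? : Decidable P) xs → ∑[ x ∈ xs ] 𝟙 (P? x) ≡ length (filter P? xs)
  ∑𝟙≡length-filter P? []       = refl
  ∑𝟙≡length-filter P? (x ∷ xs) with P? x
  ... | yes _ = cong suc (∑𝟙≡length-filter P? xs)
  ... | no  _ = ∑𝟙≡length-filter P? xs

  ∑𝟙≡length : ∀ {P : A → Set} (P? : Decidable P) {xs ys} → Unique xs → Unique ys →
    (∀ {y} → y ∈ ys ⇔ (y ∈ xs × P y)) → ∑[ x ∈ xs ] 𝟙 (P? x) ≡ length ys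
  ∑𝟙≡length P? {xs} !xs !ys ys≈ = trans (∑𝟙≡length-filter P? xs)
    (unique-set-equal⇒length≡ (filter⁺ P? !xs) !ys (mk⇔
      (λ y∈ → let y∈xs , Py = ∈-filter⁻ P? {xs = xs} y∈ in Equivalence.from ys≈ (y∈xs , Py))
      (λ y∈ys → let y∈xs , Py = Equivalence.to ys≈ y∈ys in ∈-filter⁺ P? y∈xs Py)))

∑-comm : ∀ {A B : Set} (xs : List A) (ys : List B) (f : A → B → ℕ) →
  ∑[ x ∈ xs ] ∑[ y ∈ ys ] f x y ≡ ∑[ y ∈ ys ] ∑[ x ∈ xs ] f x y
∑-comm []       ys f = sym (∑-zero ys)
∑-comm (x ∷ xs) ys f = trans (cong (∑ ys (f x) +_) (∑-comm xs ys f))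
  (sym (∑-distrib-+ ys (f x) (λ y → ∑[ x′ ∈ xs ] f x′ y)))

∑-map : ∀ {A B : Set} (g : A → B) (xs : List A) (f : B → ℕ) → ∑ (map g xs) f ≡ ∑[ x ∈ xs ] f (g x)
∑-map g []       f = refl
∑-map g (x ∷ xs) f = cong (f (g x) +_) (∑-map g xs f)

𝟙-cong : ∀ {P Q : Set} (P? : Dec P) (Q? : Dec Q) → (P → Q) → (Q → P) → 𝟙 P? ≡ 𝟙 Q?
𝟙-cong (yes _) (yes _) _   _   = refl
𝟙-cong (no _)  (no _)  _   _   = refl
𝟙-cong (yes p) (no ¬q) P⇒Q _   = contradiction (P⇒Q p) ¬q
𝟙-cong (no ¬p) (yes q) _   Q⇒P = contradiction (Q⇒P q) ¬p

𝟙-yes : ∀ {P : Set} (P? : Dec P) → P → 𝟙 P? ≡ 1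
𝟙-yes (yes _) _ = refl
𝟙-yes (no ¬p) p = contradiction p ¬p

𝟙-no : ∀ {P : Set} (P? : Dec P) → ¬ P → 𝟙 P? ≡ 0
𝟙-no (yes p) ¬p = contradiction p ¬p
𝟙-no (no _)  _  = refl

∑-upTo-suc : ∀ n f → ∑ (upTo (suc n)) f ≡ f 0 + ∑[ i ∈ upTo n ] f (suc i)
∑-upTo-suc n f = cong (f 0 +_) (trans (cong (λ is → ∑ is f) (sym (map-upTo suc n))) (∑-map suc (upTo n) f))

∑-upTo-∷ʳ : ∀ n f → ∑ (upTo (suc n)) f ≡ ∑ (upTo n) f + f n
∑-upTo-∷ʳ n f = begin
  ∑ (upTo (suc n)) f        ≡⟨ cong (λ is → ∑ is f) (sym (upTo-∷ʳ n)) ⟩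
  ∑ (upTo n ++ [ n ]) f     ≡⟨ ∑-++ (upTo n) [ n ] f ⟩
  ∑ (upTo n) f + (f n + 0)  ≡⟨ cong (∑ (upTo n) f +_) (+-identityʳ (f n)) ⟩
  ∑ (upTo n) f + f n        ∎
  where open ≡-Reasoning

∑-𝟙≟ : ∀ {A : Set} (_≟_ : DecidableEquality A) {xs x} → Unique xs → x ∈ xs →
  (f : A → ℕ) → ∑[ y ∈ xs ] (f y * 𝟙 (y ≟ x)) ≡ f x
∑-𝟙≟ _≟_ {xs} {x} !xs x∈xs f = begin
  ∑[ y ∈ xs ] (f y * 𝟙 (y ≟ x))    ≡⟨ ∑-cong {xs = xs} termwise ⟩
  ∑[ y ∈ xs ] (f x * 𝟙 (y ≟ x))    ≡⟨ ∑-distribˡ-* (f x) xs _ ⟩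
  f x * ∑[ y ∈ xs ] 𝟙 (y ≟ x)      ≡⟨ cong (f x *_) (∑𝟙≡length (_≟ x) !xs ([] ∷ []) (mk⇔
                                        (λ { (here refl) → x∈xs , refl })
                                        (λ { (_ , refl) → here refl }))) ⟩
  f x * 1                          ≡⟨ *-identityʳ (f x) ⟩
  f x                              ∎
  where
  open ≡-Reasoning
  termwise : ∀ {y} → y ∈ xs → f y * 𝟙 (y ≟ x) ≡ f x * 𝟙 (y ≟ x)
  termwise {y} _ with y ≟ x
  ... | yes refl = refl
  ... | no  _    = trans (*-zeroʳ (f y)) (sym (*-zeroʳ (f x)))

-- Polynomials over 𝔽₂

-- Every nonzero polynomial over 𝔽₂ is monic; monic cs stands for
-- cs₀ + cs₁ x + ⋯ + x ^ length cs, which makes the representation canonical.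
data Poly : Set where
  0ₚ    : Poly
  monic : List Bool → Poly

infixr 5 _∷ₚ_
infixl 6 _+ₚ_
infixl 7 _*ₚ_ _·ₚ_

_∷ₚ_ : Bool → Poly → Poly
b     ∷ₚ monic cs = monic (b ∷ cs)
false ∷ₚ 0ₚ       = 0ₚ
true  ∷ₚ 0ₚ       = monic []

_+ₘ_ : List Bool → List Bool → Poly
[]       +ₘ []       = 0ₚ
[]       +ₘ (d ∷ ds) = monic (not d ∷ ds)
(c ∷ cs) +ₘ []       = monic (not c ∷ cs)
(c ∷ cs) +ₘ (d ∷ ds) = (c xor d) ∷ₚ (cs +ₘ ds)

_+ₚ_ : Poly → Poly → Poly
0ₚ       +ₚ q        = q
monic cs +ₚ 0ₚ       = monic cs
monic cs +ₚ monic ds = cs +ₘ ds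

_·ₚ_ : Bool → Poly → Poly
false ·ₚ p = 0ₚ
true  ·ₚ p = p

1ₚ : Poly
1ₚ = monic []

_*ₘ_ : List Bool → Poly → Poly
[]       *ₘ q = q
(c ∷ cs) *ₘ q = c ·ₚ q +ₚ (false ∷ₚ cs *ₘ q)

_*ₚ_ : Poly → Poly → Poly
0ₚ       *ₚ q = 0ₚ
monic cs *ₚ q = cs *ₘ q

∷ₚ-view : ∀ p → ∃[ b ] ∃[ q ] p ≡ b ∷ₚ q
∷ₚ-view 0ₚ               = false , 0ₚ , refl
∷ₚ-view (monic [])       = true , 0ₚ , refl
∷ₚ-view (monic (c ∷ cs)) = c , monic cs , refl

∷ₚ-induction : (P : Poly → Set) → P 0ₚ → (∀ b p → P p → P (b ∷ₚ p)) → ∀ p → P p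
∷ₚ-induction P P0 P∷ 0ₚ               = P0
∷ₚ-induction P P0 P∷ (monic [])       = P∷ true 0ₚ P0
∷ₚ-induction P P0 P∷ (monic (c ∷ cs)) = P∷ c (monic cs) (∷ₚ-induction P P0 P∷ (monic cs))

+ₚ-identityʳ : ∀ p → p +ₚ 0ₚ ≡ p
+ₚ-identityʳ 0ₚ        = refl
+ₚ-identityʳ (monic _) = refl

+ₘ-comm : ∀ cs ds → cs +ₘ ds ≡ ds +ₘ cs
+ₘ-comm []       []       = refl
+ₘ-comm []       (d ∷ ds) = refl
+ₘ-comm (c ∷ cs) []       = refl
+ₘ-comm (c ∷ cs) (d ∷ ds) = cong₂ _∷ₚ_ (Boolₚ.xor-comm c d) (+ₘ-comm cs ds)

+ₚ-comm : ∀ p q → p +ₚ q ≡ q +ₚ p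
+ₚ-comm 0ₚ         0ₚ         = refl
+ₚ-comm 0ₚ         (monic _)  = refl
+ₚ-comm (monic _)  0ₚ         = refl
+ₚ-comm (monic cs) (monic ds) = +ₘ-comm cs ds

∷ₚ-+ₚ : ∀ a p b q → (a ∷ₚ p) +ₚ (b ∷ₚ q) ≡ (a xor b) ∷ₚ (p +ₚ q)
∷ₚ-+ₚ false 0ₚ         b     q          = refl
∷ₚ-+ₚ true  0ₚ         false 0ₚ         = refl
∷ₚ-+ₚ true  0ₚ         true  0ₚ         = refl
∷ₚ-+ₚ true  0ₚ         b     (monic _)  = refl
∷ₚ-+ₚ a     (monic cs) false 0ₚ         = cong (_∷ₚ monic cs) (sym (Boolₚ.xor-identityʳ a))
∷ₚ-+ₚ a     (monic cs) true  0ₚ         = cong (_∷ₚ monic cs) (sym (Boolₚ.xor-comm a true))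
∷ₚ-+ₚ a     (monic _)  b     (monic _)  = refl

+ₚ-assoc : ∀ p q r → (p +ₚ q) +ₚ r ≡ p +ₚ (q +ₚ r)
+ₚ-assoc = ∷ₚ-induction _ (λ _ _ → refl) step
  where
  step : ∀ a p → (∀ q r → (p +ₚ q) +ₚ r ≡ p +ₚ (q +ₚ r)) →
         ∀ q r → ((a ∷ₚ p) +ₚ q) +ₚ r ≡ (a ∷ₚ p) +ₚ (q +ₚ r)
  step a p ih q r with ∷ₚ-view q | ∷ₚ-view r
  ... | b , q′ , refl | c , r′ , refl
    rewrite ∷ₚ-+ₚ a p b q′ | ∷ₚ-+ₚ (a xor b) (p +ₚ q′) c r′
          | ∷ₚ-+ₚ b q′ c r′ | ∷ₚ-+ₚ a p (b xor c) (q′ +ₚ r′)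
    = cong₂ _∷ₚ_ (Boolₚ.xor-assoc a b c) (ih q′ r′)

+ₚ-self : ∀ p → p +ₚ p ≡ 0ₚ
+ₚ-self = ∷ₚ-induction _ refl λ a p ih →
  trans (∷ₚ-+ₚ a p a p) (cong₂ _∷ₚ_ (xor-same a) ih)

+ₚ-interchange : ∀ p q r s → (p +ₚ q) +ₚ (r +ₚ s) ≡ (p +ₚ r) +ₚ (q +ₚ s)
+ₚ-interchange p q r s = begin
  (p +ₚ q) +ₚ (r +ₚ s) ≡⟨ +ₚ-assoc p q (r +ₚ s) ⟩
  p +ₚ (q +ₚ (r +ₚ s)) ≡⟨ cong (p +ₚ_) (sym (+ₚ-assoc q r s)) ⟩
  p +ₚ ((q +ₚ r) +ₚ s) ≡⟨ cong (λ t → p +ₚ (t +ₚ s)) (+ₚ-comm q r) ⟩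
  p +ₚ ((r +ₚ q) +ₚ s) ≡⟨ cong (p +ₚ_) (+ₚ-assoc r q s) ⟩
  p +ₚ (r +ₚ (q +ₚ s)) ≡⟨ sym (+ₚ-assoc p r (q +ₚ s)) ⟩
  (p +ₚ r) +ₚ (q +ₚ s) ∎
  where open ≡-Reasoning

·ₚ-xor : ∀ a b p → (a xor b) ·ₚ p ≡ a ·ₚ p +ₚ b ·ₚ p
·ₚ-xor false b     p = refl
·ₚ-xor true  false p = sym (+ₚ-identityʳ p)
·ₚ-xor true  true  p = sym (+ₚ-self p)

·ₚ-∷ₚ : ∀ a b q → a ·ₚ (b ∷ₚ q) ≡ (a ∧ b) ∷ₚ (a ·ₚ q)
·ₚ-∷ₚ false false 0ₚ        = refl
·ₚ-∷ₚ false true  0ₚ        = refl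
·ₚ-∷ₚ false b     (monic _) = refl
·ₚ-∷ₚ true  b     q         = refl

∷ₚ-*ₚ : ∀ a p q → (a ∷ₚ p) *ₚ q ≡ a ·ₚ q +ₚ (false ∷ₚ p *ₚ q)
∷ₚ-*ₚ false 0ₚ        q = refl
∷ₚ-*ₚ true  0ₚ        q = sym (+ₚ-identityʳ q)
∷ₚ-*ₚ a     (monic _) q = refl

*ₚ-zeroʳ : ∀ p → p *ₚ 0ₚ ≡ 0ₚ
*ₚ-zeroʳ = ∷ₚ-induction _ refl λ a p ih →
  trans (∷ₚ-*ₚ a p 0ₚ) (trans (cong (λ t → a ·ₚ 0ₚ +ₚ (false ∷ₚ t)) ih) (zero-·ₚ a))
  where
  zero-·ₚ : ∀ a → a ·ₚ 0ₚ +ₚ 0ₚ ≡ 0ₚ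
  zero-·ₚ false = refl
  zero-·ₚ true  = refl

*ₚ-distribʳ : ∀ q p p′ → (p +ₚ p′) *ₚ q ≡ p *ₚ q +ₚ p′ *ₚ q
*ₚ-distribʳ q = ∷ₚ-induction _ (λ _ → refl) step
  where
  step : ∀ a p → (∀ p′ → (p +ₚ p′) *ₚ q ≡ p *ₚ q +ₚ p′ *ₚ q) →
         ∀ p′ → ((a ∷ₚ p) +ₚ p′) *ₚ q ≡ (a ∷ₚ p) *ₚ q +ₚ p′ *ₚ q
  step a p ih p′ with ∷ₚ-view p′
  ... | b , p″ , refl
    rewrite ∷ₚ-+ₚ a p b p″ | ∷ₚ-*ₚ (a xor b) (p +ₚ p″) q | ∷ₚ-*ₚ a p q | ∷ₚ-*ₚ b p″ q
          | ·ₚ-xor a b q | ih p″ | sym (∷ₚ-+ₚ false (p *ₚ q) false (p″ *ₚ q))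
    = +ₚ-interchange (a ·ₚ q) (b ·ₚ q) (false ∷ₚ p *ₚ q) (false ∷ₚ p″ *ₚ q)

*ₚ-∷ₚ : ∀ p b q → p *ₚ (b ∷ₚ q) ≡ b ·ₚ p +ₚ (false ∷ₚ p *ₚ q)
*ₚ-∷ₚ = ∷ₚ-induction _ base step
  where
  base : ∀ b q → 0ₚ ≡ b ·ₚ 0ₚ +ₚ 0ₚ
  base false q = refl
  base true  q = refl
  step : ∀ a p → (∀ b q → p *ₚ (b ∷ₚ q) ≡ b ·ₚ p +ₚ (false ∷ₚ p *ₚ q)) →
         ∀ b q → (a ∷ₚ p) *ₚ (b ∷ₚ q) ≡ b ·ₚ (a ∷ₚ p) +ₚ (false ∷ₚ (a ∷ₚ p) *ₚ q)
  step a p ih b q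
    rewrite ∷ₚ-*ₚ a p (b ∷ₚ q) | ih b q | ∷ₚ-*ₚ a p q | ·ₚ-∷ₚ a b q | ·ₚ-∷ₚ b a p
          | ∷ₚ-+ₚ (a ∧ b) (a ·ₚ q) false (b ·ₚ p +ₚ (false ∷ₚ p *ₚ q))
          | ∷ₚ-+ₚ (b ∧ a) (b ·ₚ p) false (a ·ₚ q +ₚ (false ∷ₚ p *ₚ q))
          | Boolₚ.∧-comm a b
    = cong (((b ∧ a) xor false) ∷ₚ_) (begin
      a ·ₚ q +ₚ (b ·ₚ p +ₚ r) ≡⟨ sym (+ₚ-assoc (a ·ₚ q) (b ·ₚ p) r) ⟩
      a ·ₚ q +ₚ b ·ₚ p +ₚ r   ≡⟨ cong (_+ₚ r) (+ₚ-comm (a ·ₚ q) (b ·ₚ p)) ⟩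
      b ·ₚ p +ₚ a ·ₚ q +ₚ r   ≡⟨ +ₚ-assoc (b ·ₚ p) (a ·ₚ q) r ⟩
      b ·ₚ p +ₚ (a ·ₚ q +ₚ r) ∎)
    where
    open ≡-Reasoning
    r = false ∷ₚ p *ₚ q

*ₚ-comm : ∀ p q → p *ₚ q ≡ q *ₚ p
*ₚ-comm = ∷ₚ-induction _ (λ q → sym (*ₚ-zeroʳ q)) λ a p ih q →
  trans (∷ₚ-*ₚ a p q) (trans (cong (λ t → a ·ₚ q +ₚ (false ∷ₚ t)) (ih q)) (sym (*ₚ-∷ₚ q a p)))

·ₚ-*ₚ : ∀ a q r → a ·ₚ q *ₚ r ≡ a ·ₚ (q *ₚ r)
·ₚ-*ₚ false q r = refl
·ₚ-*ₚ true  q r = refl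

*ₚ-assoc : ∀ p q r → (p *ₚ q) *ₚ r ≡ p *ₚ (q *ₚ r)
*ₚ-assoc = ∷ₚ-induction _ (λ _ _ → refl) λ a p ih q r →
  begin
    ((a ∷ₚ p) *ₚ q) *ₚ r                              ≡⟨ cong (_*ₚ r) (∷ₚ-*ₚ a p q) ⟩
    (a ·ₚ q +ₚ (false ∷ₚ p *ₚ q)) *ₚ r                ≡⟨ *ₚ-distribʳ r (a ·ₚ q) _ ⟩
    a ·ₚ q *ₚ r +ₚ (false ∷ₚ p *ₚ q) *ₚ r             ≡⟨ cong₂ _+ₚ_ (·ₚ-*ₚ a q r) (∷ₚ-*ₚ false (p *ₚ q) r) ⟩
    a ·ₚ (q *ₚ r) +ₚ (false ∷ₚ (p *ₚ q) *ₚ r)         ≡⟨ cong (λ t → a ·ₚ (q *ₚ r) +ₚ (false ∷ₚ t)) (ih q r) ⟩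
    a ·ₚ (q *ₚ r) +ₚ (false ∷ₚ p *ₚ (q *ₚ r))         ≡⟨ sym (∷ₚ-*ₚ a p (q *ₚ r)) ⟩
    (a ∷ₚ p) *ₚ (q *ₚ r)                              ∎
  where open ≡-Reasoning

poly-commutativeSemiring : CommutativeSemiring 0ℓ 0ℓ
poly-commutativeSemiring = record
  { _+_ = _+ₚ_
  ; _*_ = _*ₚ_
  ; 0#  = 0ₚ
  ; 1#  = 1ₚ
  ; isCommutativeSemiring = isCommutativeSemiringˡ record
    { +-isCommutativeMonoid = record
      { isMonoid = record
        { isSemigroup = record
          { isMagma = record { isEquivalence = isEquivalence ; ∙-cong = cong₂ _+ₚ_ }
          ; assoc   = +ₚ-assoc
          }
        ; identity = (λ _ → refl) , +ₚ-identityʳ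
        }
      ; comm = +ₚ-comm
      }
    ; *-isCommutativeMonoid = record
      { isMonoid = record
        { isSemigroup = record
          { isMagma = record { isEquivalence = isEquivalence ; ∙-cong = cong₂ _*ₚ_ }
          ; assoc   = *ₚ-assoc
          }
        ; identity = (λ _ → refl) , (λ p → *ₚ-comm p 1ₚ)
        }
      ; comm = *ₚ-comm
      }
    ; distribʳ = *ₚ-distribʳ
    ; zeroˡ    = λ _ → refl
    }
  }

module PolySolver = CharacteristicTwoSolver poly-commutativeSemiring +ₚ-self

open MonoidDivisibility (CommutativeSemiring.*-monoid poly-commutativeSemiring)
  using (_,_; ε∣ʳ_; ∣ʳ-refl; ∣ʳ-trans; x∣ʳyx; x∣ʳy⇒x∣ʳzy) renaming (_∣_ to _∣ₚ_)

X : Poly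
X = monic (false ∷ [])

∷ₚ-as-sum : ∀ a p → a ∷ₚ p ≡ a ·ₚ 1ₚ +ₚ X *ₚ p
∷ₚ-as-sum false p          = refl
∷ₚ-as-sum true  0ₚ         = refl
∷ₚ-as-sum true  (monic cs) = refl

size : Poly → ℕ
size 0ₚ         = 0
size (monic cs) = suc (length cs)

size-∷ₚ : ∀ a p → size (a ∷ₚ p) ≤ suc (size p)
size-∷ₚ a     (monic cs) = ≤-refl
size-∷ₚ false 0ₚ         = z≤n
size-∷ₚ true  0ₚ         = s≤s z≤n

size-·ₚ : ∀ a p → size (a ·ₚ p) ≤ size p
size-·ₚ false p = z≤n
size-·ₚ true  p = ≤-refl

size-+ₘ : ∀ {k} cs ds → length cs < k → length ds < k → size (cs +ₘ ds) ≤ k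
size-+ₘ []       []       _   _   = z≤n
size-+ₘ []       (d ∷ ds) _   lt  = lt
size-+ₘ (c ∷ cs) []       lt  _   = lt
size-+ₘ {suc k} (c ∷ cs) (d ∷ ds) (s≤s lt) (s≤s lt′) =
  ≤-trans (size-∷ₚ (c xor d) (cs +ₘ ds)) (s≤s (size-+ₘ cs ds lt lt′))

size-+ₚ : ∀ {k} p q → size p ≤ k → size q ≤ k → size (p +ₚ q) ≤ k
size-+ₚ 0ₚ         q          _  q≤ = q≤
size-+ₚ (monic cs) 0ₚ         p≤ _  = p≤
size-+ₚ (monic cs) (monic ds) p≤ q≤ = size-+ₘ cs ds p≤ q≤

-- The leading terms cancel.
size-+ₘ-same : ∀ cs ds → length cs ≡ length ds → size (cs +ₘ ds) ≤ length ds
size-+ₘ-same []       []       _  = z≤n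
size-+ₘ-same (c ∷ cs) (d ∷ ds) eq =
  ≤-trans (size-∷ₚ (c xor d) (cs +ₘ ds)) (s≤s (size-+ₘ-same cs ds (cong pred eq)))

size-+ₚ-same : ∀ p ds → size p ≡ suc (length ds) → size (p +ₚ monic ds) ≤ length ds
size-+ₚ-same (monic cs) ds eq = size-+ₘ-same cs ds (cong pred eq)

+ₘ-lower : ∀ cs ds → length cs < length ds → ∃[ es ] cs +ₘ ds ≡ monic es × length es ≡ length ds
+ₘ-lower []       (d ∷ ds) _        = not d ∷ ds , refl , refl
+ₘ-lower (c ∷ cs) (d ∷ ds) (s≤s lt) with +ₘ-lower cs ds lt
... | es , eq , len = (c xor d) ∷ es , cong ((c xor d) ∷ₚ_) eq , cong suc len

+ₚ-lower : ∀ p ds → size p ≤ length ds → ∃[ es ] p +ₚ monic ds ≡ monic es × length es ≡ length ds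
+ₚ-lower 0ₚ         ds _  = ds , refl , refl
+ₚ-lower (monic cs) ds lt = +ₘ-lower cs ds lt

monic-*ₚ-monic : ∀ cs ds →
  ∃[ es ] monic cs *ₚ monic ds ≡ monic es × length es ≡ length cs + length ds
monic-*ₚ-monic []       ds = ds , refl , refl
monic-*ₚ-monic (c ∷ cs) ds =
  let es , eq , len = monic-*ₚ-monic cs ds
      fs , eq′ , len′ = +ₚ-lower (c ·ₚ monic ds) (false ∷ es)
        (≤-trans (size-·ₚ c (monic ds)) (s≤s (subst (length ds ≤_) (sym len) (m≤n+m _ _))))
  in fs , trans (cong (λ t → c ·ₚ monic ds +ₚ (false ∷ₚ t)) eq) eq′ , trans len′ (cong suc len)

infixl 7 _⊛_
_⊛_ : List Bool → List Bool → List Bool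
cs ⊛ ds = proj₁ (monic-*ₚ-monic cs ds)

monic-⊛ : ∀ cs ds → monic cs *ₚ monic ds ≡ monic (cs ⊛ ds)
monic-⊛ cs ds = proj₁ (proj₂ (monic-*ₚ-monic cs ds))

length-⊛ : ∀ cs ds → length (cs ⊛ ds) ≡ length cs + length ds
length-⊛ cs ds = proj₂ (proj₂ (monic-*ₚ-monic cs ds))

size-*ₚ-monic≤⇒0ₚ : ∀ h ds → size (h *ₚ monic ds) ≤ length ds → h ≡ 0ₚ
size-*ₚ-monic≤⇒0ₚ 0ₚ         ds _ = refl
size-*ₚ-monic≤⇒0ₚ (monic cs) ds le rewrite monic-⊛ cs ds | length-⊛ cs ds =
  contradiction (≤-trans (s≤s (m≤n+m (length ds) (length cs))) le) (<-irrefl refl)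

+ₚ≡0ₚ⇒≡ : ∀ p q → p +ₚ q ≡ 0ₚ → p ≡ q
+ₚ≡0ₚ⇒≡ p q eq = begin
  p               ≡⟨ solve 2 (λ p q → p := (p :+ q) :+ q) refl p q ⟩
  (p +ₚ q) +ₚ q   ≡⟨ cong (_+ₚ q) eq ⟩
  q               ∎
  where
  open ≡-Reasoning
  open PolySolver

*ₚ-cancelʳ-monic : ∀ ds h h′ → h *ₚ monic ds ≡ h′ *ₚ monic ds → h ≡ h′
*ₚ-cancelʳ-monic ds h h′ eq = +ₚ≡0ₚ⇒≡ h h′ (size-*ₚ-monic≤⇒0ₚ (h +ₚ h′) ds
  (subst (λ t → size t ≤ length ds) (sym difference≡0) z≤n))
  where
  open ≡-Reasoning
  difference≡0 : (h +ₚ h′) *ₚ monic ds ≡ 0ₚ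
  difference≡0 = begin
    (h +ₚ h′) *ₚ monic ds            ≡⟨ *ₚ-distribʳ (monic ds) h h′ ⟩
    h *ₚ monic ds +ₚ h′ *ₚ monic ds  ≡⟨ cong (_+ₚ h′ *ₚ monic ds) eq ⟩
    h′ *ₚ monic ds +ₚ h′ *ₚ monic ds ≡⟨ +ₚ-self (h′ *ₚ monic ds) ⟩
    0ₚ                               ∎

∣ₚ-+ₚ : ∀ {g p q} → g ∣ₚ p → g ∣ₚ q → g ∣ₚ p +ₚ q
∣ₚ-+ₚ {g} (h , hg≡p) (h′ , h′g≡q) = h +ₚ h′ , trans (*ₚ-distribʳ g h h′) (cong₂ _+ₚ_ hg≡p h′g≡q)

∣ₚ-monic⇒⊛ : ∀ {ks fs} → monic ks ∣ₚ monic fs → ∃[ hs ] fs ≡ hs ⊛ ks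
∣ₚ-monic⇒⊛ {ks} (monic hs , hk≡f) = hs , monic-injective (trans (sym hk≡f) (monic-⊛ hs ks))
  where
  monic-injective : ∀ {cs ds} → monic cs ≡ monic ds → cs ≡ ds
  monic-injective refl = refl

∣ₚ-monic⇒length≤ : ∀ {ks fs} → monic ks ∣ₚ monic fs → length ks ≤ length fs
∣ₚ-monic⇒length≤ {ks} ks∣fs with ∣ₚ-monic⇒⊛ ks∣fs
... | hs , refl = subst (length ks ≤_) (sym (length-⊛ hs ks)) (m≤n+m (length ks) (length hs))

module Division (ds : List Bool) where

  IsDivMod : Poly → Poly × Poly → Set
  IsDivMod p (q , r) = p ≡ q *ₚ monic ds +ₚ r × size r ≤ length ds

  private
    open ≡-Reasoning
    open PolySolver

    g = monic ds

    -- Long division, reading the coefficients of the dividend from the leading one down.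
    step : Bool → Poly × Poly → Poly × Poly
    step a (q , r) with size (a ∷ₚ r) ≤? length ds
    ... | yes _ = false ∷ₚ q , a ∷ₚ r
    ... | no  _ = true ∷ₚ q , (a ∷ₚ r) +ₚ g

    step-correct : ∀ a p q r → IsDivMod p (q , r) → IsDivMod (a ∷ₚ p) (step a (q , r))
    step-correct a p q r (p≡ , r<) with size (a ∷ₚ r) ≤? length ds
    ... | yes ar< = (begin
      a ∷ₚ p
        ≡⟨ cong (a ∷ₚ_) p≡ ⟩
      a ∷ₚ (q *ₚ g +ₚ r)
        ≡⟨ ∷ₚ-as-sum a _ ⟩
      a ·ₚ 1ₚ +ₚ X *ₚ (q *ₚ g +ₚ r)
        ≡⟨ solve 5 (λ A X q g r → A :+ X :* (q :* g :+ r) := (X :* q) :* g :+ (A :+ X :* r))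
             refl (a ·ₚ 1ₚ) X q g r ⟩
      (X *ₚ q) *ₚ g +ₚ (a ·ₚ 1ₚ +ₚ X *ₚ r)
        ≡⟨ cong ((X *ₚ q) *ₚ g +ₚ_) (sym (∷ₚ-as-sum a r)) ⟩
      (false ∷ₚ q) *ₚ g +ₚ (a ∷ₚ r) ∎) , ar<
    ... | no ar≮ = (begin
      a ∷ₚ p
        ≡⟨ cong (a ∷ₚ_) p≡ ⟩
      a ∷ₚ (q *ₚ g +ₚ r)
        ≡⟨ ∷ₚ-as-sum a _ ⟩
      a ·ₚ 1ₚ +ₚ X *ₚ (q *ₚ g +ₚ r)
        ≡⟨ solve 5 (λ A X q g r → A :+ X :* (q :* g :+ r) := (con true :+ X :* q) :* g :+ (A :+ X :* r :+ g))
             refl (a ·ₚ 1ₚ) X q g r ⟩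
      (1ₚ +ₚ X *ₚ q) *ₚ g +ₚ (a ·ₚ 1ₚ +ₚ X *ₚ r +ₚ g)
        ≡⟨ cong₂ (λ s t → s *ₚ g +ₚ (t +ₚ g)) (sym (∷ₚ-as-sum true q)) (sym (∷ₚ-as-sum a r)) ⟩
      (true ∷ₚ q) *ₚ g +ₚ ((a ∷ₚ r) +ₚ g) ∎) ,
      size-+ₚ-same (a ∷ₚ r) ds (≤-antisym (≤-trans (size-∷ₚ a r) (s≤s r<)) (≰⇒> ar≮))

    divModₘ : List Bool → Poly × Poly
    divModₘ []       = step true (0ₚ , 0ₚ)
    divModₘ (c ∷ cs) = step c (divModₘ cs)

    divModₘ-correct : ∀ cs → IsDivMod (monic cs) (divModₘ cs)
    divModₘ-correct []       = step-correct true 0ₚ 0ₚ 0ₚ (refl , z≤n)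
    divModₘ-correct (c ∷ cs) = step-correct c (monic cs) _ _ (divModₘ-correct cs)

  divMod : Poly → Poly × Poly
  divMod 0ₚ         = 0ₚ , 0ₚ
  divMod (monic cs) = divModₘ cs

  divMod-correct : ∀ p → IsDivMod p (divMod p)
  divMod-correct 0ₚ         = refl , z≤n
  divMod-correct (monic cs) = divModₘ-correct cs

  quot rem : Poly → Poly
  quot p = proj₁ (divMod p)
  rem  p = proj₂ (divMod p)

  size-rem : ∀ p → size (rem p) ≤ length ds
  size-rem p = proj₂ (divMod-correct p)

  remainder-unique : ∀ {p} qr qr′ → IsDivMod p qr → IsDivMod p qr′ → proj₂ qr ≡ proj₂ qr′
  remainder-unique {p} (q , r) (q′ , r′) (p≡ , r<) (p≡′ , r′<) =
    +ₚ≡0ₚ⇒≡ r r′ (trans r+r′≡ (cong (_*ₚ g) q+q′≡0))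
    where
    r+r′≡ : r +ₚ r′ ≡ (q +ₚ q′) *ₚ g
    r+r′≡ = begin
      r +ₚ r′
        ≡⟨ solve 5 (λ q q′ g r r′ → r :+ r′ := (q :* g :+ r) :+ (q′ :* g :+ r′) :+ (q :+ q′) :* g)
             refl q q′ g r r′ ⟩
      (q *ₚ g +ₚ r) +ₚ (q′ *ₚ g +ₚ r′) +ₚ (q +ₚ q′) *ₚ g
        ≡⟨ cong (_+ₚ (q +ₚ q′) *ₚ g) (trans (cong₂ _+ₚ_ (sym p≡) (sym p≡′)) (+ₚ-self p)) ⟩
      (q +ₚ q′) *ₚ g ∎
    q+q′≡0 : q +ₚ q′ ≡ 0ₚ
    q+q′≡0 = size-*ₚ-monic≤⇒0ₚ (q +ₚ q′) ds
      (subst (λ t → size t ≤ length ds) r+r′≡ (size-+ₚ r r′ r< r′<))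

  rem-+ₚ : ∀ p p′ → rem (p +ₚ p′) ≡ rem p +ₚ rem p′
  rem-+ₚ p p′ = remainder-unique (divMod (p +ₚ p′)) (quot p +ₚ quot p′ , rem p +ₚ rem p′)
    (divMod-correct (p +ₚ p′)) sum-isDivMod
    where
    sum-isDivMod : IsDivMod (p +ₚ p′) (quot p +ₚ quot p′ , rem p +ₚ rem p′)
    sum-isDivMod =
      trans (cong₂ _+ₚ_ (proj₁ (divMod-correct p)) (proj₁ (divMod-correct p′)))
        (solve 5 (λ q r q′ r′ g → (q :* g :+ r) :+ (q′ :* g :+ r′) := (q :+ q′) :* g :+ (r :+ r′))
          refl (quot p) (rem p) (quot p′) (rem p′) g) ,
      size-+ₚ (rem p) (rem p′) (size-rem p) (size-rem p′)

  rem≡0ₚ⇒∣ₚ : ∀ p → rem p ≡ 0ₚ → monic ds ∣ₚ p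
  rem≡0ₚ⇒∣ₚ p r≡0 = quot p , sym (begin
    p                                ≡⟨ proj₁ (divMod-correct p) ⟩
    quot p *ₚ monic ds +ₚ rem p      ≡⟨ cong (quot p *ₚ monic ds +ₚ_) r≡0 ⟩
    quot p *ₚ monic ds +ₚ 0ₚ         ≡⟨ +ₚ-identityʳ _ ⟩
    quot p *ₚ monic ds               ∎)

  ∣ₚ⇒rem≡0ₚ : ∀ p → monic ds ∣ₚ p → rem p ≡ 0ₚ
  ∣ₚ⇒rem≡0ₚ p (h , hg≡p) = remainder-unique (divMod p) (h , 0ₚ) (divMod-correct p)
    (trans (sym hg≡p) (sym (+ₚ-identityʳ _)) , z≤n)

infix 4 _∣ₚ?_
_∣ₚ?_ : ∀ ds p → Dec (monic ds ∣ₚ p)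
ds ∣ₚ? p with Division.rem ds p in r≡
... | 0ₚ      = yes (Division.rem≡0ₚ⇒∣ₚ ds p r≡)
... | monic _ = no (λ g∣p → contradiction (trans (sym r≡) (Division.∣ₚ⇒rem≡0ₚ ds p g∣p)) λ ())

ProperFactor : List Bool → List Bool → Set
ProperFactor ks ms = 1 ≤ length ks × length ks < length ms × monic ks ∣ₚ monic ms

Irreducible : List Bool → Set
Irreducible ms = 1 ≤ length ms × (∀ ks → ¬ ProperFactor ks ms)

module _ {ms} (ms-irreducible : Irreducible ms) where
  private
    open ≡-Reasoning
    open PolySolver
    g = monic ms

    -- Reduce ms modulo the cofactor ks: a zero remainder would make ks a proper factor of ms,
    -- any other remainder is a shorter cofactor.
    cofactor-descent : ∀ ks → Acc _<_ (length ks) → length ks < length ms →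
                       ∀ b → g ∣ₚ monic ks *ₚ b → g ∣ₚ b
    cofactor-descent []          _        _     b g∣b   = g∣b
    cofactor-descent ks@(_ ∷ _) (acc rec) ks<ms b g∣ksb
      with Division.divMod ks g | Division.divMod-correct ks g
    ... | q , 0ₚ       | g≡ , _ =
      contradiction (s≤s z≤n , ks<ms , q , sym (trans g≡ (+ₚ-identityʳ _))) (proj₂ ms-irreducible ks)
    ... | q , monic rs | g≡ , rs<ks =
      cofactor-descent rs (rec rs<ks) (<-trans rs<ks ks<ms) b
        (subst (g ∣ₚ_) (sym rs*b≡) (∣ₚ-+ₚ (x∣ʳyx g b) (x∣ʳy⇒x∣ʳzy q g∣ksb)))
      where
      rs*b≡ : monic rs *ₚ b ≡ b *ₚ g +ₚ q *ₚ (monic ks *ₚ b)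
      rs*b≡ = begin
        monic rs *ₚ b
          ≡⟨ solve 4 (λ q K R b → R :* b := b :* (q :* K :+ R) :+ q :* (K :* b)) refl q (monic ks) (monic rs) b ⟩
        b *ₚ (q *ₚ monic ks +ₚ monic rs) +ₚ q *ₚ (monic ks *ₚ b)
          ≡⟨ cong (λ t → b *ₚ t +ₚ q *ₚ (monic ks *ₚ b)) (sym g≡) ⟩
        b *ₚ g +ₚ q *ₚ (monic ks *ₚ b) ∎

  euclidsLemma : ∀ a b → g ∣ₚ a *ₚ b → g ∣ₚ a ⊎ g ∣ₚ b
  euclidsLemma a b g∣ab with Division.divMod ms a | Division.divMod-correct ms a
  ... | q , 0ₚ       | a≡ , _     = inj₁ (q , sym (trans a≡ (+ₚ-identityʳ _)))
  ... | q , monic rs | a≡ , rs<ms = inj₂ (cofactor-descent rs (<-wellFounded _) rs<ms b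
    (subst (g ∣ₚ_) (sym rs*b≡) (∣ₚ-+ₚ g∣ab (x∣ʳyx g (q *ₚ b)))))
    where
    rs*b≡ : monic rs *ₚ b ≡ a *ₚ b +ₚ (q *ₚ b) *ₚ g
    rs*b≡ = begin
      monic rs *ₚ b
        ≡⟨ solve 4 (λ q g R b → R :* b := (q :* g :+ R) :* b :+ (q :* b) :* g) refl q g (monic rs) b ⟩
      (q *ₚ g +ₚ monic rs) *ₚ b +ₚ (q *ₚ b) *ₚ g
        ≡⟨ cong (λ t → t *ₚ b +ₚ (q *ₚ b) *ₚ g) (sym a≡) ⟩
      a *ₚ b +ₚ (q *ₚ b) *ₚ g ∎

irreducible∣irreducible⇒≡ : ∀ {ks ls} → Irreducible ks → Irreducible ls → monic ks ∣ₚ monic ls → ks ≡ ls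
irreducible∣irreducible⇒≡ {ks} (1≤ks , _) (_ , ls-irreducible) ks∣ls with ∣ₚ-monic⇒⊛ ks∣ls
... | []     , refl = refl
... | h ∷ hs , refl = contradiction (1≤ks , ks<ls , ks∣ls) (ls-irreducible ks)
  where
  ks<ls : length ks < length ((h ∷ hs) ⊛ ks)
  ks<ls = subst (length ks <_) (sym (length-⊛ (h ∷ hs) ks)) (s≤s (m≤n+m (length ks) (length hs)))

monics : ℕ → List (List Bool)
monics n = map toList (vectors n)

monicsBelow : ℕ → List (List Bool)
monicsBelow zero    = []
monicsBelow (suc n) = monicsBelow n ++ monics n

∈-monics : ∀ ks → ks ∈ monics (length ks)
∈-monics ks = subst (_∈ monics (length ks)) (toList∘fromList ks) (∈-map⁺ toList (∈-vectors (fromList ks)))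

∈-monics⁻ : ∀ {n ks} → ks ∈ monics n → length ks ≡ n
∈-monics⁻ ks∈ with ∈-map⁻ toList ks∈
... | v , _ , refl = length-toList v

monics-unique : ∀ n → Unique (monics n)
monics-unique n = map⁺ (λ {v} {w} eq → trans (sym (cast-is-id refl v)) (toList-injective refl v w eq))
  (vectors-unique n)

length-monics : ∀ n → length (monics n) ≡ 2 ^ n
length-monics n = trans (length-map toList (vectors n)) (length-vectors n)

∈-monicsBelow : ∀ {n ks} → length ks < n → ks ∈ monicsBelow n
∈-monicsBelow {suc n} {ks} (s≤s ks≤n) with m≤n⇒m<n∨m≡n ks≤n
... | inj₁ ks<n  = ∈-++⁺ˡ (∈-monicsBelow ks<n)
... | inj₂ refl  = ∈-++⁺ʳ (monicsBelow (length ks)) (∈-monics ks)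

∈-monicsBelow⁻ : ∀ {n ks} → ks ∈ monicsBelow n → length ks < n
∈-monicsBelow⁻ {suc n} ks∈ with ∈-++⁻ (monicsBelow n) ks∈
... | inj₁ ks∈below = m<n⇒m<1+n (∈-monicsBelow⁻ ks∈below)
... | inj₂ ks∈monics = s≤s (≤-reflexive (∈-monics⁻ ks∈monics))

monicsBelow-unique : ∀ n → Unique (monicsBelow n)
monicsBelow-unique zero    = []
monicsBelow-unique (suc n) = ++⁺ (monicsBelow-unique n) (monics-unique n)
  λ (ks∈below , ks∈monics) → <-irrefl (∈-monics⁻ ks∈monics) (∈-monicsBelow⁻ ks∈below)

properFactor? : ∀ ks ms → Dec (ProperFactor ks ms)
properFactor? ks ms = 1 ≤? length ks ×-dec suc (length ks) ≤? length ms ×-dec ks ∣ₚ? monic ms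

irreducible-or-properFactor : ∀ ms → 1 ≤ length ms → Irreducible ms ⊎ ∃[ ks ] ProperFactor ks ms
irreducible-or-properFactor ms 1≤ms with any? (λ ks → properFactor? ks ms) (monicsBelow (length ms))
... | yes factor = inj₂ (satisfied factor)
... | no ¬factor = inj₁ (1≤ms , λ ks factor@(_ , ks<ms , _) → ¬factor (lose (∈-monicsBelow ks<ms) factor))

irreducible? : ∀ ms → Dec (Irreducible ms)
irreducible? ms with 1 ≤? length ms
... | no  1≰ms = no (1≰ms ∘ proj₁)
... | yes 1≤ms with irreducible-or-properFactor ms 1≤ms
...   | inj₁ irreducible    = yes irreducible
...   | inj₂ (ks , factor) = no (λ irreducible → proj₂ irreducible ks factor)

irreducible-factor : ∀ ms → 1 ≤ length ms → ∃[ ks ] Irreducible ks × monic ks ∣ₚ monic ms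
irreducible-factor ms = go ms (<-wellFounded (length ms))
  where
  go : ∀ ms → Acc _<_ (length ms) → 1 ≤ length ms → ∃[ ks ] Irreducible ks × monic ks ∣ₚ monic ms
  go ms (acc rec) 1≤ms with irreducible-or-properFactor ms 1≤ms
  ... | inj₁ irreducible = ms , irreducible , ∣ʳ-refl
  ... | inj₂ (ks , 1≤ks , ks<ms , ks∣ms) =
    let js , irreducible , js∣ks = go ks (rec ks<ms) 1≤ks in js , irreducible , ∣ʳ-trans js∣ks ks∣ms

infixr 8 _^ₘ_
_^ₘ_ : List Bool → ℕ → List Bool
ks ^ₘ zero  = []
ks ^ₘ suc j = ks ⊛ ks ^ₘ j

length-^ₘ : ∀ ks j → length (ks ^ₘ j) ≡ j * length ks
length-^ₘ ks zero    = refl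
length-^ₘ ks (suc j) = trans (length-⊛ ks (ks ^ₘ j)) (cong (length ks +_) (length-^ₘ ks j))

length-^ₘ≥ : ∀ j {ks} → 1 ≤ length ks → j ≤ length (ks ^ₘ j)
length-^ₘ≥ j {ks} 1≤ks =
  subst (j ≤_) (sym (length-^ₘ ks j)) (subst (_≤ j * length ks) (*-identityʳ j) (*-monoʳ-≤ j 1≤ks))

monic-^ₘ-suc : ∀ ks j → monic (ks ^ₘ suc j) ≡ monic (ks ^ₘ j) *ₚ monic ks
monic-^ₘ-suc ks j = trans (sym (monic-⊛ ks (ks ^ₘ j))) (*ₚ-comm (monic ks) _)

kʲ∣p⇒kʲ⁺¹∣pk : ∀ ks j p → monic (ks ^ₘ j) ∣ₚ p → monic (ks ^ₘ suc j) ∣ₚ p *ₚ monic ks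
kʲ∣p⇒kʲ⁺¹∣pk ks j p (h , hk≡p) = h , (begin
  h *ₚ monic (ks ^ₘ suc j)               ≡⟨ cong (h *ₚ_) (monic-^ₘ-suc ks j) ⟩
  h *ₚ (monic (ks ^ₘ j) *ₚ monic ks)     ≡⟨ sym (*ₚ-assoc h _ _) ⟩
  (h *ₚ monic (ks ^ₘ j)) *ₚ monic ks     ≡⟨ cong (_*ₚ monic ks) hk≡p ⟩
  p *ₚ monic ks                          ∎)
  where open ≡-Reasoning

kʲ⁺¹∣pk⇒kʲ∣p : ∀ ks j p → monic (ks ^ₘ suc j) ∣ₚ p *ₚ monic ks → monic (ks ^ₘ j) ∣ₚ p
kʲ⁺¹∣pk⇒kʲ∣p ks j p (h , hk≡pk) = h , *ₚ-cancelʳ-monic ks _ p (begin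
  (h *ₚ monic (ks ^ₘ j)) *ₚ monic ks     ≡⟨ *ₚ-assoc h _ _ ⟩
  h *ₚ (monic (ks ^ₘ j) *ₚ monic ks)     ≡⟨ cong (h *ₚ_) (sym (monic-^ₘ-suc ks j)) ⟩
  h *ₚ monic (ks ^ₘ suc j)               ≡⟨ hk≡pk ⟩
  p *ₚ monic ks                          ∎)
  where open ≡-Reasoning

kʲ∣pl⇒kʲ∣p : ∀ {ks ls} → Irreducible ks → Irreducible ls → ks ≢ ls →
  ∀ j p → monic (ks ^ₘ j) ∣ₚ p *ₚ monic ls → monic (ks ^ₘ j) ∣ₚ p
kʲ∣pl⇒kʲ∣p ks-irr ls-irr ks≢ls zero    p _ = p , *ₚ-comm p 1ₚ
kʲ∣pl⇒kʲ∣p {ks} {ls} ks-irr ls-irr ks≢ls (suc j) p kʲ⁺¹∣pl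
  with euclidsLemma ks-irr p (monic ls) (∣ʳ-trans (monic (ks ^ₘ j) , sym (monic-^ₘ-suc ks j)) kʲ⁺¹∣pl)
... | inj₂ ks∣ls = contradiction (irreducible∣irreducible⇒≡ ks-irr ls-irr ks∣ls) ks≢ls
... | inj₁ (h , hk≡p) = subst (monic (ks ^ₘ suc j) ∣ₚ_) hk≡p
  (kʲ∣p⇒kʲ⁺¹∣pk ks j h (kʲ∣pl⇒kʲ∣p ks-irr ls-irr ks≢ls j h
    (kʲ⁺¹∣pk⇒kʲ∣p ks j (h *ₚ monic ls) (subst (monic (ks ^ₘ suc j) ∣ₚ_) (hl·k≡pl) kʲ⁺¹∣pl))))
  where
  open PolySolver
  hl·k≡pl : p *ₚ monic ls ≡ (h *ₚ monic ls) *ₚ monic ks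
  hl·k≡pl = trans (cong (_*ₚ monic ls) (sym hk≡p))
    (solve 3 (λ h k l → (h :* k) :* l := (h :* l) :* k) refl h (monic ks) (monic ls))

_≟ₗ_ : DecidableEquality (List Bool)
_≟ₗ_ = Listₚ.≡-dec Boolₚ._≟_

-- Counting irreducible polynomials

-- The number of j ∈ [1, N] with ks ^ j ∣ p: the multiplicity of ks in p, truncated at N.
multiplicity : ℕ → List Bool → Poly → ℕ
multiplicity N ks p = ∑[ i ∈ upTo N ] 𝟙 (ks ^ₘ suc i ∣ₚ? p)

multiplicity-1ₚ : ∀ N {ks} → 1 ≤ length ks → multiplicity N ks 1ₚ ≡ 0
multiplicity-1ₚ N {ks} 1≤ks = trans (∑-cong {xs = upTo N} λ {i} _ → 𝟙-no (ks ^ₘ suc i ∣ₚ? 1ₚ) λ kʲ∣1 →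
    contradiction (≤-trans (length-^ₘ≥ (suc i) {ks} 1≤ks) (∣ₚ-monic⇒length≤ kʲ∣1)) λ ())
  (∑-zero (upTo N))

multiplicity-*ₚ-irreducible : ∀ N {ks ls} hs → Irreducible ks → Irreducible ls → length hs < N →
  multiplicity N ks (monic hs *ₚ monic ls) ≡ 𝟙 (ks ≟ₗ ls) + multiplicity N ks (monic hs)
multiplicity-*ₚ-irreducible N {ks} {ls} hs ks-irr ls-irr hs<N with ks ≟ₗ ls
... | no ks≢ls = ∑-cong {xs = upTo N} λ {i} _ → 𝟙-cong (ks ^ₘ suc i ∣ₚ? _) (ks ^ₘ suc i ∣ₚ? _)
  (kʲ∣pl⇒kʲ∣p ks-irr ls-irr ks≢ls (suc i) (monic hs))
  (λ kʲ∣h → subst (_ ∣ₚ_) (*ₚ-comm (monic ls) (monic hs)) (x∣ʳy⇒x∣ʳzy (monic ls) kʲ∣h))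
-- kʲ⁺¹ ∣ h k iff kʲ ∣ h shifts the exponents from [1, N] to [0, N − 1];
-- k⁰ ∣ h holds and kᴺ ∤ h for degree reasons.
... | yes refl = begin
  multiplicity N ks (h *ₚ k)
    ≡⟨ ∑-cong {xs = upTo N} (λ {i} _ →
         𝟙-cong (ks ^ₘ suc i ∣ₚ? _) (ks ^ₘ i ∣ₚ? _) (kʲ⁺¹∣pk⇒kʲ∣p ks i h) (kʲ∣p⇒kʲ⁺¹∣pk ks i h)) ⟩
  ∑[ i ∈ upTo N ] 𝟙 (ks ^ₘ i ∣ₚ? h)
    ≡⟨ sym (+-identityʳ _) ⟩
  ∑[ i ∈ upTo N ] 𝟙 (ks ^ₘ i ∣ₚ? h) + 0
    ≡⟨ cong (∑[ i ∈ upTo N ] 𝟙 (ks ^ₘ i ∣ₚ? h) +_) (sym (𝟙-no (ks ^ₘ N ∣ₚ? h) kᴺ∤h)) ⟩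
  ∑[ i ∈ upTo N ] 𝟙 (ks ^ₘ i ∣ₚ? h) + 𝟙 (ks ^ₘ N ∣ₚ? h)
    ≡⟨ sym (∑-upTo-∷ʳ N _) ⟩
  ∑[ i ∈ upTo (suc N) ] 𝟙 (ks ^ₘ i ∣ₚ? h)
    ≡⟨ ∑-upTo-suc N _ ⟩
  𝟙 ([] ∣ₚ? h) + multiplicity N ks h
    ≡⟨ cong (_+ multiplicity N ks h) (𝟙-yes ([] ∣ₚ? h) (ε∣ʳ h)) ⟩
  1 + multiplicity N ks h ∎
  where
  open ≡-Reasoning
  h = monic hs
  k = monic ks
  kᴺ∤h : ¬ monic (ks ^ₘ N) ∣ₚ h
  kᴺ∤h kᴺ∣h =
    <-irrefl refl (<-≤-trans hs<N (≤-trans (length-^ₘ≥ N {ks} (proj₁ ks-irr)) (∣ₚ-monic⇒length≤ kᴺ∣h)))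

irreducibles : ℕ → List (List Bool)
irreducibles N = filter irreducible? (monicsBelow (suc N))

irreducibles-unique : ∀ N → Unique (irreducibles N)
irreducibles-unique N = filter⁺ irreducible? (monicsBelow-unique (suc N))

∈-irreducibles⁺ : ∀ {N ks} → Irreducible ks → length ks ≤ N → ks ∈ irreducibles N
∈-irreducibles⁺ irreducible ks≤N = ∈-filter⁺ irreducible? (∈-monicsBelow (s≤s ks≤N)) irreducible

∈-irreducibles⁻ : ∀ {N ks} → ks ∈ irreducibles N → Irreducible ks × length ks ≤ N
∈-irreducibles⁻ {N} ks∈ =
  let ks∈below , irreducible = ∈-filter⁻ irreducible? {xs = monicsBelow (suc N)} ks∈
  in irreducible , ≤-pred (∈-monicsBelow⁻ ks∈below)

-- Unique factorisation, in the form: the degree of a monic polynomial is the sum of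
-- the degrees of its irreducible factors, counted with multiplicity.
degree-formula : ∀ N fs → length fs ≤ N →
  ∑[ ks ∈ irreducibles N ] (length ks * multiplicity N ks (monic fs)) ≡ length fs
degree-formula N fs = go fs (<-wellFounded (length fs))
  where
  open ≡-Reasoning
  go : ∀ fs → Acc _<_ (length fs) → length fs ≤ N →
       ∑[ ks ∈ irreducibles N ] (length ks * multiplicity N ks (monic fs)) ≡ length fs
  go [] _ _ = trans
    (∑-cong {xs = irreducibles N} λ {ks} ks∈ →
      trans (cong (length ks *_) (multiplicity-1ₚ N {ks} (proj₁ (proj₁ (∈-irreducibles⁻ {N} ks∈)))))
        (*-zeroʳ (length ks)))
    (∑-zero (irreducibles N))
  go fs@(_ ∷ _) (acc rec) fs≤N with irreducible-factor fs (s≤s z≤n)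
  ... | ls , ls-irr , ls∣fs with ∣ₚ-monic⇒⊛ ls∣fs
  ...   | hs , fs≡ = begin
    ∑[ ks ∈ irreducibles N ] (length ks * multiplicity N ks (monic fs))
      ≡⟨ ∑-cong {xs = irreducibles N} termwise ⟩
    ∑[ ks ∈ irreducibles N ] (length ks * 𝟙 (ks ≟ₗ ls) + length ks * multiplicity N ks (monic hs))
      ≡⟨ ∑-distrib-+ (irreducibles N) _ _ ⟩
    ∑[ ks ∈ irreducibles N ] (length ks * 𝟙 (ks ≟ₗ ls)) +
    ∑[ ks ∈ irreducibles N ] (length ks * multiplicity N ks (monic hs))
      ≡⟨ cong₂ _+_ (∑-𝟙≟ _≟ₗ_ (irreducibles-unique N) (∈-irreducibles⁺ {N} ls-irr (≤-trans ls≤fs fs≤N))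
                     length)
                   (go hs (rec hs<fs) (≤-trans (<⇒≤ hs<fs) fs≤N)) ⟩
    length ls + length hs
      ≡⟨ +-comm (length ls) (length hs) ⟩
    length hs + length ls
      ≡⟨ sym (trans (cong length fs≡) (length-⊛ hs ls)) ⟩
    length fs ∎
    where
    ls≤fs : length ls ≤ length fs
    ls≤fs = ∣ₚ-monic⇒length≤ ls∣fs
    hs<fs : length hs < length fs
    hs<fs = subst (length hs <_) (sym (trans (cong length fs≡) (length-⊛ hs ls)))
      (subst (_≤ length hs + length ls) (+-comm (length hs) 1) (+-monoʳ-≤ (length hs) (proj₁ ls-irr)))
    termwise : ∀ {ks} → ks ∈ irreducibles N → length ks * multiplicity N ks (monic fs) ≡
                 length ks * 𝟙 (ks ≟ₗ ls) + length ks * multiplicity N ks (monic hs)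
    termwise {ks} ks∈ = begin
      length ks * multiplicity N ks (monic fs)
        ≡⟨ cong (λ f → length ks * multiplicity N ks f) (trans (cong monic fs≡) (sym (monic-⊛ hs ls))) ⟩
      length ks * multiplicity N ks (monic hs *ₚ monic ls)
        ≡⟨ cong (length ks *_) (multiplicity-*ₚ-irreducible N {ks} {ls} hs
             (proj₁ (∈-irreducibles⁻ {N} ks∈)) ls-irr (<-≤-trans hs<fs fs≤N)) ⟩
      length ks * (𝟙 (ks ≟ₗ ls) + multiplicity N ks (monic hs))
        ≡⟨ *-distribˡ-+ (length ks) _ _ ⟩
      length ks * 𝟙 (ks ≟ₗ ls) + length ks * multiplicity N ks (monic hs) ∎

multiples : ℕ → ℕ → ℕ
multiples e n with e ≤? n
... | yes _ = 2 ^ (n ∸ e)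
... | no  _ = 0

multiples-pos : ∀ {e n} → e ≤ n → 1 ≤ multiples e n
multiples-pos {e} {n} e≤n with e ≤? n
... | yes _   = m^n>0 2 (n ∸ e)
... | no  e≰n = contradiction e≤n e≰n

multiples-suc : ∀ e n → multiples e (suc n) ≡ 2 * multiples e n + 𝟙 (e ≟ suc n)
multiples-suc e n with e ≤? n | e ≤? suc n | e ≟ suc n
... | yes e≤n | yes _     | no  _    = trans (cong (2 ^_) (+-∸-assoc 1 e≤n)) (sym (+-identityʳ _))
... | yes e≤n | _         | yes refl = contradiction e≤n (<-irrefl refl)
... | yes e≤n | no  e≰1+n | _        = contradiction (m≤n⇒m≤1+n e≤n) e≰1+n
... | no  _   | yes _     | yes refl = cong (2 ^_) (n∸n≡0 (suc n))
... | no  e≰n | yes e≤1+n | no  e≢   = contradiction (≤-antisym e≤1+n (≰⇒> e≰n)) e≢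
... | no  _   | no  e≰1+n | yes refl = contradiction ≤-refl e≰1+n
... | no  _   | no  _     | no  _    = refl

count-multiples : ∀ n ks → ∑[ fs ∈ monics n ] 𝟙 (ks ∣ₚ? monic fs) ≡ multiples (length ks) n
count-multiples n ks with length ks ≤? n
... | yes ks≤n = begin
  ∑[ fs ∈ monics n ] 𝟙 (ks ∣ₚ? monic fs)  ≡⟨ ∑𝟙≡length (λ fs → ks ∣ₚ? monic fs) (monics-unique n)
                                               (map⁺ ⊛-injectiveˡ (monics-unique (n ∸ length ks))) multiples≈ ⟩
  length (map (_⊛ ks) (monics (n ∸ length ks))) ≡⟨ length-map (_⊛ ks) (monics (n ∸ length ks)) ⟩
  length (monics (n ∸ length ks))               ≡⟨ length-monics (n ∸ length ks) ⟩
  2 ^ (n ∸ length ks)                           ∎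
  where
  open ≡-Reasoning
  ⊛-injectiveˡ : ∀ {hs hs′} → hs ⊛ ks ≡ hs′ ⊛ ks → hs ≡ hs′
  ⊛-injectiveˡ {hs} {hs′} eq with *ₚ-cancelʳ-monic ks (monic hs) (monic hs′)
    (trans (monic-⊛ hs ks) (trans (cong monic eq) (sym (monic-⊛ hs′ ks))))
  ... | refl = refl
  multiples≈ : ∀ {fs} → fs ∈ map (_⊛ ks) (monics (n ∸ length ks)) ⇔ (fs ∈ monics n × monic ks ∣ₚ monic fs)
  multiples≈ {fs} = mk⇔
    (λ fs∈ → let hs , hs∈ , fs≡ = ∈-map⁻ (_⊛ ks) fs∈ in
      subst (λ m → fs ∈ monics m) (begin
        length fs               ≡⟨ cong length fs≡ ⟩
        length (hs ⊛ ks)        ≡⟨ length-⊛ hs ks ⟩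
        length hs + length ks   ≡⟨ cong (_+ length ks) (∈-monics⁻ hs∈) ⟩
        n ∸ length ks + length ks ≡⟨ m∸n+n≡m ks≤n ⟩
        n                       ∎) (∈-monics fs) ,
      (monic hs , trans (monic-⊛ hs ks) (cong monic (sym fs≡))))
    (λ (fs∈ , ks∣fs) → let hs , fs≡ = ∣ₚ-monic⇒⊛ ks∣fs in
      subst (_∈ map (_⊛ ks) (monics (n ∸ length ks))) (sym fs≡)
        (∈-map⁺ (_⊛ ks) (subst (λ m → hs ∈ monics m) (begin
          length hs                          ≡⟨ sym (m+n∸n≡m (length hs) (length ks)) ⟩
          length hs + length ks ∸ length ks  ≡⟨ cong (_∸ length ks) (sym (length-⊛ hs ks)) ⟩
          length (hs ⊛ ks) ∸ length ks       ≡⟨ cong (λ gs → length gs ∸ length ks) (sym fs≡) ⟩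
          length fs ∸ length ks              ≡⟨ cong (_∸ length ks) (∈-monics⁻ fs∈) ⟩
          n ∸ length ks                      ∎) (∈-monics hs))))
... | no ks≰n = trans
  (∑-cong {xs = monics n} λ fs∈ → 𝟙-no (ks ∣ₚ? _) λ ks∣fs →
    ks≰n (subst (length ks ≤_) (∈-monics⁻ fs∈) (∣ₚ-monic⇒length≤ ks∣fs)))
  (∑-zero (monics n))

∑-degree-formula : ∀ {N n} → n ≤ N →
  n * 2 ^ n ≡ ∑[ ks ∈ irreducibles N ] (length ks * ∑[ i ∈ upTo N ] multiples (suc i * length ks) n)
∑-degree-formula {N} {n} n≤N = begin
  n * 2 ^ n
    ≡⟨ cong (n *_) (sym (length-monics n)) ⟩
  n * length (monics n)
    ≡⟨ sym (∑-const (monics n) n) ⟩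
  ∑[ fs ∈ monics n ] n
    ≡⟨ ∑-cong {xs = monics n} (λ {fs} fs∈ → trans (sym (∈-monics⁻ fs∈))
         (sym (degree-formula N fs (subst (_≤ N) (sym (∈-monics⁻ fs∈)) n≤N)))) ⟩
  ∑[ fs ∈ monics n ] ∑[ ks ∈ Irr ] (length ks * multiplicity N ks (monic fs))
    ≡⟨ ∑-comm (monics n) Irr _ ⟩
  ∑[ ks ∈ Irr ] ∑[ fs ∈ monics n ] (length ks * multiplicity N ks (monic fs))
    ≡⟨ ∑-cong {xs = Irr} (λ {ks} _ → begin
         ∑[ fs ∈ monics n ] (length ks * multiplicity N ks (monic fs))
           ≡⟨ ∑-distribˡ-* (length ks) (monics n) _ ⟩
         length ks * ∑[ fs ∈ monics n ] multiplicity N ks (monic fs)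
           ≡⟨ cong (length ks *_) (∑-comm (monics n) (upTo N) _) ⟩
         length ks * ∑[ i ∈ upTo N ] ∑[ fs ∈ monics n ] 𝟙 (ks ^ₘ suc i ∣ₚ? monic fs)
           ≡⟨ cong (length ks *_) (∑-cong {xs = upTo N} λ {i} _ →
                trans (count-multiples n (ks ^ₘ suc i)) (cong (λ e → multiples e n) (length-^ₘ ks (suc i)))) ⟩
         length ks * ∑[ i ∈ upTo N ] multiples (suc i * length ks) n ∎) ⟩
  ∑[ ks ∈ Irr ] (length ks * ∑[ i ∈ upTo N ] multiples (suc i * length ks) n) ∎
  where
  open ≡-Reasoning
  Irr = irreducibles N

-- The sum of deg k over the powers kʲ of degree m of irreducible polynomials k
-- (the polynomial analogue of ∑ Λ), restricted to deg k ≤ N and j ≤ N.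
mangoldt : ℕ → ℕ → ℕ
mangoldt N m = ∑[ ks ∈ irreducibles N ] (length ks * ∑[ i ∈ upTo N ] 𝟙 (suc i * length ks ≟ m))

mangoldt≡2^ : ∀ {N m} → 1 ≤ m → m ≤ N → mangoldt N m ≡ 2 ^ m
mangoldt≡2^ {N} {suc n} _ 1+n≤N = +-cancelˡ-≡ (2 * (n * 2 ^ n)) _ _ (begin
  2 * (n * 2 ^ n) + mangoldt N (suc n)
    ≡⟨ cong (λ t → 2 * t + mangoldt N (suc n)) (∑-degree-formula (≤-trans (n≤1+n n) 1+n≤N)) ⟩
  2 * ∑[ ks ∈ Irr ] (length ks * ∑[ i ∈ upTo N ] multiples (suc i * length ks) n) + mangoldt N (suc n)
    ≡⟨ cong (_+ mangoldt N (suc n)) (sym (∑-distribˡ-* 2 Irr _)) ⟩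
  ∑[ ks ∈ Irr ] (2 * (length ks * ∑[ i ∈ upTo N ] multiples (suc i * length ks) n)) + mangoldt N (suc n)
    ≡⟨ sym (∑-distrib-+ Irr _ _) ⟩
  ∑[ ks ∈ Irr ] (2 * (length ks * ∑[ i ∈ upTo N ] multiples (suc i * length ks) n) +
                 length ks * ∑[ i ∈ upTo N ] 𝟙 (suc i * length ks ≟ suc n))
    ≡⟨ ∑-cong {xs = Irr} (λ {ks} _ → sym (termwise (length ks))) ⟩
  ∑[ ks ∈ Irr ] (length ks * ∑[ i ∈ upTo N ] multiples (suc i * length ks) (suc n))
    ≡⟨ sym (∑-degree-formula 1+n≤N) ⟩
  suc n * 2 ^ suc n
    ≡⟨ solve 2 (λ n p → (con 1 :+ n) :* (con 2 :* p) := con 2 :* (n :* p) :+ con 2 :* p) refl n (2 ^ n) ⟩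
  2 * (n * 2 ^ n) + 2 ^ suc n ∎)
  where
  open ≡-Reasoning
  open +-*-Solver
  Irr = irreducibles N
  termwise : ∀ d → d * ∑[ i ∈ upTo N ] multiples (suc i * d) (suc n) ≡
    2 * (d * ∑[ i ∈ upTo N ] multiples (suc i * d) n) + d * ∑[ i ∈ upTo N ] 𝟙 (suc i * d ≟ suc n)
  termwise d = begin
    d * ∑[ i ∈ upTo N ] multiples (suc i * d) (suc n)
      ≡⟨ cong (d *_) (∑-cong {xs = upTo N} λ {i} _ → multiples-suc (suc i * d) n) ⟩
    d * ∑[ i ∈ upTo N ] (2 * multiples (suc i * d) n + 𝟙 (suc i * d ≟ suc n))
      ≡⟨ cong (d *_) (trans (∑-distrib-+ (upTo N) _ _)
           (cong (_+ ∑[ i ∈ upTo N ] 𝟙 (suc i * d ≟ suc n)) (∑-distribˡ-* 2 (upTo N) _))) ⟩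
    d * (2 * ∑[ i ∈ upTo N ] multiples (suc i * d) n + ∑[ i ∈ upTo N ] 𝟙 (suc i * d ≟ suc n))
      ≡⟨ solve 3 (λ d a b → d :* (con 2 :* a :+ b) := con 2 :* (d :* a) :+ d :* b) refl d _ _ ⟩
    2 * (d * ∑[ i ∈ upTo N ] multiples (suc i * d) n) + d * ∑[ i ∈ upTo N ] 𝟙 (suc i * d ≟ suc n) ∎

n<2^n : ∀ n → n < 2 ^ n
n<2^n zero    = s≤s z≤n
n<2^n (suc n) = +-mono-≤ (m^n>0 2 n) (subst (suc n ≤_) (sym (+-identityʳ (2 ^ n))) (n<2^n n))

⌊n/2⌋+⌊n/2⌋≤n : ∀ n → ⌊ n /2⌋ + ⌊ n /2⌋ ≤ n
⌊n/2⌋+⌊n/2⌋≤n n = ≤-trans (+-monoʳ-≤ ⌊ n /2⌋ (⌊n/2⌋≤⌈n/2⌉ n)) (≤-reflexive (⌊n/2⌋+⌈n/2⌉≡n n))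

m+m≤n⇒m≤⌊n/2⌋ : ∀ {m n} → m + m ≤ n → m ≤ ⌊ n /2⌋
m+m≤n⇒m≤⌊n/2⌋ {m} m+m≤n = subst (_≤ _) (sym (n≡⌊n+n/2⌋ m)) (⌊n/2⌋-mono m+m≤n)

∑𝟙-multiples-below : ∀ N {d m} → N * d < m → ∑[ i ∈ upTo N ] 𝟙 (suc i * d ≟ m) ≡ 0
∑𝟙-multiples-below N {d} {m} Nd<m = trans
  (∑-cong {xs = upTo N} λ {i} i∈ → 𝟙-no (suc i * d ≟ m) λ eq →
    <-irrefl eq (≤-<-trans (*-monoˡ-≤ d (∈-upTo⁻ i∈)) Nd<m))
  (∑-zero (upTo N))

-- At most one i has (i + 1) · d = m, and then i ≥ 1 since d ≢ m.
at-most-one-multiple : ∀ N {d m} → 1 ≤ d → d ≢ m → ∑[ i ∈ upTo N ] 𝟙 (suc i * d ≟ m) ≤ 𝟙 (d + d ≤? m)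
at-most-one-multiple zero          _   _   = z≤n
at-most-one-multiple (suc zero)    {d} {m} _ d≢m =
  ≤-trans (≤-reflexive (cong (_+ 0) (𝟙-no (d + 0 ≟ m) (d≢m ∘ trans (sym (+-identityʳ d)))))) z≤n
at-most-one-multiple (suc (suc N)) {d} {m} 1≤d d≢m =
  ≤-trans (≤-reflexive (∑-upTo-∷ʳ (suc N) (λ i → 𝟙 (suc i * d ≟ m)))) 
    (last-multiple (suc (suc N) * d ≟ m) (at-most-one-multiple (suc N) 1≤d d≢m))
  where
  last-multiple : (D : Dec (suc (suc N) * d ≡ m)) →
                  ∑[ i ∈ upTo (suc N) ] 𝟙 (suc i * d ≟ m) ≤ 𝟙 (d + d ≤? m) →
                  ∑[ i ∈ upTo (suc N) ] 𝟙 (suc i * d ≟ m) + 𝟙 D ≤ 𝟙 (d + d ≤? m)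
  last-multiple (no _)   ih = ≤-trans (≤-reflexive (+-identityʳ _)) ih
  last-multiple (yes eq) _  = ≤-reflexive (trans
    (cong (_+ 1) (∑𝟙-multiples-below (suc N) (subst (suc N * d <_) eq (m<n+m (suc N * d) 1≤d))))
    (sym (𝟙-yes (d + d ≤? m) (subst (d + d ≤_) eq (+-monoʳ-≤ d (m≤m+n d (N * d)))))))

𝟙-half≤multiples : ∀ {d m} → 1 ≤ m → 𝟙 (d + d ≤? m) ≤ ∑[ i ∈ upTo m ] multiples (suc i * d) ⌊ m /2⌋
𝟙-half≤multiples {d} {suc m} _ with d + d ≤? suc m
... | no  _     = z≤n
... | yes d+d≤m = ≤-trans
  (multiples-pos (subst (_≤ ⌊ suc m /2⌋) (sym (+-identityʳ d)) (m+m≤n⇒m≤⌊n/2⌋ d+d≤m)))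
  (m≤m+n _ _)

irreducible-of-degree : ∀ m → 1 ≤ m → ∃[ ks ] length ks ≡ m × Irreducible ks
irreducible-of-degree m 1≤m with any? irreducible? (monics m)
... | yes found = let ks , ks∈ , irreducible = find found in ks , ∈-monics⁻ ks∈ , irreducible
... | no  none  = contradiction 2^m≤h2^h (<⇒≱ h2^h<2^m)
  where
  open ≤-Reasoning
  h = ⌊ m /2⌋
  not-of-degree-m : ∀ {ks} → Irreducible ks → length ks ≢ m
  not-of-degree-m {ks} irreducible refl = none (lose (∈-monics ks) irreducible)
  2^m≤h2^h : 2 ^ m ≤ h * 2 ^ h
  2^m≤h2^h = begin
    2 ^ m         ≡⟨ sym (mangoldt≡2^ 1≤m ≤-refl) ⟩
    mangoldt m m  ≤⟨ ∑-mono-≤ {xs = irreducibles m} (λ {ks} ks∈ →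
                       let irreducible , _ = ∈-irreducibles⁻ {m} ks∈ in
                       *-monoʳ-≤ (length ks) (≤-trans
                         (at-most-one-multiple m (proj₁ irreducible) (not-of-degree-m irreducible))
                         (𝟙-half≤multiples {length ks} 1≤m))) ⟩
    ∑[ ks ∈ irreducibles m ] (length ks * ∑[ i ∈ upTo m ] multiples (suc i * length ks) h)
                  ≡⟨ sym (∑-degree-formula (⌊n/2⌋≤n m)) ⟩
    h * 2 ^ h     ∎
  h2^h<2^m : h * 2 ^ h < 2 ^ m
  h2^h<2^m = begin-strict
    h * 2 ^ h        <⟨ m<n+m (h * 2 ^ h) (m^n>0 2 h) ⟩
    suc h * 2 ^ h    ≤⟨ *-monoˡ-≤ (2 ^ h) (n<2^n h) ⟩
    2 ^ h * 2 ^ h    ≡⟨ sym (^-distribˡ-+-* 2 h h) ⟩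
    2 ^ (h + h)      ≤⟨ ^-monoʳ-≤ 2 (⌊n/2⌋+⌊n/2⌋≤n m) ⟩
    2 ^ m            ∎

-- The field with 2ⁿ elements on bit vectors

headₚ : Poly → Bool
headₚ 0ₚ               = false
headₚ (monic [])       = true
headₚ (monic (c ∷ _))  = c

tailₚ : Poly → Poly
tailₚ 0ₚ               = 0ₚ
tailₚ (monic [])       = 0ₚ
tailₚ (monic (_ ∷ cs)) = monic cs

∷ₚ-headₚ-tailₚ : ∀ p → headₚ p ∷ₚ tailₚ p ≡ p
∷ₚ-headₚ-tailₚ 0ₚ               = refl
∷ₚ-headₚ-tailₚ (monic [])       = refl
∷ₚ-headₚ-tailₚ (monic (_ ∷ _))  = refl

headₚ-∷ₚ : ∀ b p → headₚ (b ∷ₚ p) ≡ b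
headₚ-∷ₚ false 0ₚ        = refl
headₚ-∷ₚ true  0ₚ        = refl
headₚ-∷ₚ b     (monic _) = refl

tailₚ-∷ₚ : ∀ b p → tailₚ (b ∷ₚ p) ≡ p
tailₚ-∷ₚ false 0ₚ        = refl
tailₚ-∷ₚ true  0ₚ        = refl
tailₚ-∷ₚ b     (monic _) = refl

size-tailₚ : ∀ {n} p → size p ≤ suc n → size (tailₚ p) ≤ n
size-tailₚ 0ₚ                _        = z≤n
size-tailₚ (monic [])        _        = z≤n
size-tailₚ (monic (_ ∷ _))   (s≤s le) = le

toPoly : ∀ {n} → Bits n → Poly
toPoly []      = 0ₚ
toPoly (b ∷ v) = b ∷ₚ toPoly v

fromPoly : ∀ n → Poly → Bits n
fromPoly zero    p = []
fromPoly (suc n) p = headₚ p ∷ fromPoly n (tailₚ p)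

fromPoly-toPoly : ∀ {n} (v : Bits n) → fromPoly n (toPoly v) ≡ v
fromPoly-toPoly []      = refl
fromPoly-toPoly (b ∷ v) =
  cong₂ _∷_ (headₚ-∷ₚ b (toPoly v)) (trans (cong (fromPoly _) (tailₚ-∷ₚ b (toPoly v))) (fromPoly-toPoly v))

toPoly-fromPoly : ∀ n p → size p ≤ n → toPoly (fromPoly n p) ≡ p
toPoly-fromPoly zero    0ₚ _  = refl
toPoly-fromPoly (suc n) p  le =
  trans (cong (headₚ p ∷ₚ_) (toPoly-fromPoly n (tailₚ p) (size-tailₚ p le))) (∷ₚ-headₚ-tailₚ p)

toPoly-injective : ∀ {n} {v w : Bits n} → toPoly v ≡ toPoly w → v ≡ w
toPoly-injective {v = v} {w} eq =
  trans (sym (fromPoly-toPoly v)) (trans (cong (fromPoly _) eq) (fromPoly-toPoly w))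

toPoly-0ᵛ : ∀ n → toPoly (0ᵛ {n}) ≡ 0ₚ
toPoly-0ᵛ zero    = refl
toPoly-0ᵛ (suc n) = cong (false ∷ₚ_) (toPoly-0ᵛ n)

toPoly-⊕ : ∀ {n} (v w : Bits n) → toPoly (v ⊕ w) ≡ toPoly v +ₚ toPoly w
toPoly-⊕ []      []      = refl
toPoly-⊕ (a ∷ v) (b ∷ w) =
  trans (cong ((a xor b) ∷ₚ_) (toPoly-⊕ v w)) (sym (∷ₚ-+ₚ a (toPoly v) b (toPoly w)))

size-toPoly : ∀ {n} (v : Bits n) → size (toPoly v) ≤ n
size-toPoly []      = z≤n
size-toPoly (b ∷ v) = ≤-trans (size-∷ₚ b (toPoly v)) (s≤s (size-toPoly v))

record NonsingularProduct (n : ℕ) : Set where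
  infixl 7 _·_
  field
    _·_              : Bits n → Bits n → Bits n
    ·-comm           : ∀ a b → a · b ≡ b · a
    ·-distribʳ-⊕     : ∀ a b c → (a ⊕ b) · c ≡ a · c ⊕ b · c
    ·-noZeroDivisors : ∀ a b → a · b ≡ 0ᵛ → a ≡ 0ᵛ ⊎ b ≡ 0ᵛ

module Residues {ms : List Bool} (ms-irreducible : Irreducible ms) where
  open Division ms

  infixl 7 _·_
  _·_ : Bits (length ms) → Bits (length ms) → Bits (length ms)
  a · b = fromPoly (length ms) (rem (toPoly a *ₚ toPoly b))

  toPoly-· : ∀ a b → toPoly (a · b) ≡ rem (toPoly a *ₚ toPoly b)
  toPoly-· a b = toPoly-fromPoly (length ms) _ (size-rem (toPoly a *ₚ toPoly b))

  ·-comm : ∀ a b → a · b ≡ b · a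
  ·-comm a b = cong (fromPoly (length ms) ∘ rem) (*ₚ-comm (toPoly a) (toPoly b))

  ·-distribʳ-⊕ : ∀ a b c → (a ⊕ b) · c ≡ a · c ⊕ b · c
  ·-distribʳ-⊕ a b c = toPoly-injective (begin
    toPoly ((a ⊕ b) · c)                      ≡⟨ toPoly-· (a ⊕ b) c ⟩
    rem (toPoly (a ⊕ b) *ₚ C)                 ≡⟨ cong (λ p → rem (p *ₚ C)) (toPoly-⊕ a b) ⟩
    rem ((A +ₚ B) *ₚ C)                       ≡⟨ cong rem (*ₚ-distribʳ C A B) ⟩
    rem (A *ₚ C +ₚ B *ₚ C)                    ≡⟨ rem-+ₚ (A *ₚ C) (B *ₚ C) ⟩
    rem (A *ₚ C) +ₚ rem (B *ₚ C)              ≡⟨ sym (cong₂ _+ₚ_ (toPoly-· a c) (toPoly-· b c)) ⟩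
    toPoly (a · c) +ₚ toPoly (b · c)          ≡⟨ sym (toPoly-⊕ (a · c) (b · c)) ⟩
    toPoly (a · c ⊕ b · c)                    ∎)
    where
    open ≡-Reasoning
    A = toPoly a
    B = toPoly b
    C = toPoly c

  private
    multiple⇒0ᵛ : ∀ a → monic ms ∣ₚ toPoly a → a ≡ 0ᵛ
    multiple⇒0ᵛ a (h , hg≡a)
      with size-*ₚ-monic≤⇒0ₚ h ms (subst (λ p → size p ≤ length ms) (sym hg≡a) (size-toPoly a))
    ... | refl = toPoly-injective (trans (sym hg≡a) (sym (toPoly-0ᵛ (length ms))))

  ·-noZeroDivisors : ∀ a b → a · b ≡ 0ᵛ → a ≡ 0ᵛ ⊎ b ≡ 0ᵛ
  ·-noZeroDivisors a b ab≡0 with euclidsLemma ms-irreducible (toPoly a) (toPoly b)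
    (rem≡0ₚ⇒∣ₚ (toPoly a *ₚ toPoly b)
      (trans (sym (toPoly-· a b)) (trans (cong toPoly ab≡0) (toPoly-0ᵛ (length ms)))))
  ... | inj₁ g∣a = inj₁ (multiple⇒0ᵛ a g∣a)
  ... | inj₂ g∣b = inj₂ (multiple⇒0ᵛ b g∣b)

nonsingularProduct : ∀ n → 1 ≤ n → NonsingularProduct n
nonsingularProduct n 1≤n with irreducible-of-degree n 1≤n
... | ms , refl , ms-irreducible = record { Residues ms-irreducible }

-- Quadratic maps

alternating⇒polar-form : ∀ {w} d (γ : Bits d → Bits d → Bits w) →
  (∀ a b c → γ (a ⊕ b) c ≡ γ a c ⊕ γ b c) → (∀ a b → γ a b ≡ γ b a) → (∀ a → γ a a ≡ 0ᵛ) →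
  Σ[ f ∈ (Bits d → Bits w) ] ∀ a b → f (a ⊕ b) ≡ f a ⊕ f b ⊕ γ a b
alternating⇒polar-form zero    γ _     _     γ-alt = (λ _ → 0ᵛ) , λ where
  [] [] → sym (trans (cong₂ _⊕_ (⊕-self 0ᵛ) (γ-alt [])) (⊕-self 0ᵛ))
alternating⇒polar-form {w} (suc d) γ γ-add γ-sym γ-alt = f , f-polar
  where
  open ≡-Reasoning
  open BitsSolver {w}
  γ′ : Bits d → Bits d → Bits w
  γ′ a b = γ (false ∷ a) (false ∷ b)
  f′-with-polar : Σ[ f′ ∈ (Bits d → Bits w) ] ∀ a b → f′ (a ⊕ b) ≡ f′ a ⊕ f′ b ⊕ γ′ a b
  f′-with-polar = alternating⇒polar-form d γ′
    (λ a b c → γ-add (false ∷ a) (false ∷ b) (false ∷ c)) (λ a b → γ-sym (false ∷ a) (false ∷ b))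
    (λ a → γ-alt (false ∷ a))
  f′ : Bits d → Bits w
  f′ = proj₁ f′-with-polar
  f′-polar : ∀ a b → f′ (a ⊕ b) ≡ f′ a ⊕ f′ b ⊕ γ′ a b
  f′-polar = proj₂ f′-with-polar
  e₀ : Bits (suc d)
  e₀ = true ∷ 0ᵛ
  h : Bits d → Bits w
  h b = γ e₀ (false ∷ b)
  f : Bits (suc d) → Bits w
  f (false ∷ a) = f′ a
  f (true  ∷ a) = h a ⊕ f′ a
  γ-addʳ : ∀ a b c → γ a (b ⊕ c) ≡ γ a b ⊕ γ a c
  γ-addʳ a b c = trans (γ-sym a (b ⊕ c)) (trans (γ-add b c a) (cong₂ _⊕_ (γ-sym b a) (γ-sym c a)))
  true∷≡ : ∀ a → true ∷ a ≡ e₀ ⊕ (false ∷ a)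
  true∷≡ a = cong (true ∷_) (sym (⊕-identityˡ a))
  γ-TF : ∀ a b → γ (true ∷ a) (false ∷ b) ≡ h b ⊕ γ′ a b
  γ-TF a b = trans (cong (λ x → γ x (false ∷ b)) (true∷≡ a)) (γ-add e₀ (false ∷ a) (false ∷ b))
  γ-FT : ∀ a b → γ (false ∷ a) (true ∷ b) ≡ h a ⊕ γ′ a b
  γ-FT a b = trans (cong (γ (false ∷ a)) (true∷≡ b))
    (trans (γ-addʳ (false ∷ a) e₀ (false ∷ b)) (cong (_⊕ γ′ a b) (γ-sym (false ∷ a) e₀)))
  γ-TT : ∀ a b → γ (true ∷ a) (true ∷ b) ≡ h b ⊕ (h a ⊕ γ′ a b)
  γ-TT a b = begin
    γ (true ∷ a) (true ∷ b)                       ≡⟨ cong (λ x → γ x (true ∷ b)) (true∷≡ a) ⟩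
    γ (e₀ ⊕ (false ∷ a)) (true ∷ b)               ≡⟨ γ-add e₀ (false ∷ a) (true ∷ b) ⟩
    γ e₀ (true ∷ b) ⊕ γ (false ∷ a) (true ∷ b)    ≡⟨ cong₂ _⊕_ (cong (γ e₀) (true∷≡ b)) (γ-FT a b) ⟩
    γ e₀ (e₀ ⊕ (false ∷ b)) ⊕ (h a ⊕ γ′ a b)      ≡⟨ cong (_⊕ (h a ⊕ γ′ a b)) (γ-addʳ e₀ e₀ (false ∷ b)) ⟩
    γ e₀ e₀ ⊕ h b ⊕ (h a ⊕ γ′ a b)                ≡⟨ cong (λ x → x ⊕ h b ⊕ (h a ⊕ γ′ a b)) (γ-alt e₀) ⟩
    0ᵛ ⊕ h b ⊕ (h a ⊕ γ′ a b)                     ≡⟨ cong (_⊕ (h a ⊕ γ′ a b)) (⊕-identityˡ (h b)) ⟩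
    h b ⊕ (h a ⊕ γ′ a b)                          ∎
  f-polar : ∀ a b → f (a ⊕ b) ≡ f a ⊕ f b ⊕ γ a b
  f-polar (false ∷ a) (false ∷ b) = f′-polar a b
  f-polar (true ∷ a) (false ∷ b) = begin
    h (a ⊕ b) ⊕ f′ (a ⊕ b)
      ≡⟨ cong₂ _⊕_ (γ-addʳ e₀ (false ∷ a) (false ∷ b)) (f′-polar a b) ⟩
    h a ⊕ h b ⊕ (f′ a ⊕ f′ b ⊕ γ′ a b)
      ≡⟨ solve 5 (λ ha hb fa fb g → ha :+ hb :+ (fa :+ fb :+ g) := ha :+ fa :+ fb :+ (hb :+ g))
           refl (h a) (h b) (f′ a) (f′ b) (γ′ a b) ⟩
    h a ⊕ f′ a ⊕ f′ b ⊕ (h b ⊕ γ′ a b)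
      ≡⟨ cong (h a ⊕ f′ a ⊕ f′ b ⊕_) (sym (γ-TF a b)) ⟩
    h a ⊕ f′ a ⊕ f′ b ⊕ γ (true ∷ a) (false ∷ b) ∎
  f-polar (false ∷ a) (true ∷ b) = begin
    h (a ⊕ b) ⊕ f′ (a ⊕ b)
      ≡⟨ cong₂ _⊕_ (γ-addʳ e₀ (false ∷ a) (false ∷ b)) (f′-polar a b) ⟩
    h a ⊕ h b ⊕ (f′ a ⊕ f′ b ⊕ γ′ a b)
      ≡⟨ solve 5 (λ ha hb fa fb g → ha :+ hb :+ (fa :+ fb :+ g) := fa :+ (hb :+ fb) :+ (ha :+ g))
           refl (h a) (h b) (f′ a) (f′ b) (γ′ a b) ⟩
    f′ a ⊕ (h b ⊕ f′ b) ⊕ (h a ⊕ γ′ a b)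
      ≡⟨ cong (f′ a ⊕ (h b ⊕ f′ b) ⊕_) (sym (γ-FT a b)) ⟩
    f′ a ⊕ (h b ⊕ f′ b) ⊕ γ (false ∷ a) (true ∷ b) ∎
  f-polar (true ∷ a) (true ∷ b) = begin
    f′ (a ⊕ b)
      ≡⟨ f′-polar a b ⟩
    f′ a ⊕ f′ b ⊕ γ′ a b
      ≡⟨ solve 5 (λ ha hb fa fb g → fa :+ fb :+ g := ha :+ fa :+ (hb :+ fb) :+ (hb :+ (ha :+ g)))
           refl (h a) (h b) (f′ a) (f′ b) (γ′ a b) ⟩
    h a ⊕ f′ a ⊕ (h b ⊕ f′ b) ⊕ (h b ⊕ (h a ⊕ γ′ a b))
      ≡⟨ cong (h a ⊕ f′ a ⊕ (h b ⊕ f′ b) ⊕_) (sym (γ-TT a b)) ⟩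
    h a ⊕ f′ a ⊕ (h b ⊕ f′ b) ⊕ γ (true ∷ a) (true ∷ b) ∎

-- In ℤ₄ⁿ the difference (b ⊕ u + 2 f (b ⊕ u)) − (b + 2 f b) has low part u and high part
-- b ∧ u ⊕ f (b ⊕ u) ⊕ f b (see embedᵛ-difference below).
DifferenceSurjective : ∀ {n} → (Bits n → Bits n) → Set
DifferenceSurjective {n} f = ∀ u → u ≢ 0ᵛ → ∀ v → ∃[ b ] b ∧ᵛ u ⊕ (f (b ⊕ u) ⊕ f b) ≡ v

module QuadraticMap {n} (P : NonsingularProduct n) where
  open NonsingularProduct P
  open ≡-Reasoning
  open BitsSolver {n}

  ·-distribˡ-⊕ : ∀ a b c → a · (b ⊕ c) ≡ a · b ⊕ a · c
  ·-distribˡ-⊕ a b c =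
    trans (·-comm a (b ⊕ c)) (trans (·-distribʳ-⊕ b c a) (cong₂ _⊕_ (·-comm b a) (·-comm c a)))

  ·-cancelʳ : ∀ {u} → u ≢ 0ᵛ → ∀ {a b} → a · u ≡ b · u → a ≡ b
  ·-cancelʳ {u} u≢0 {a} {b} au≡bu with ·-noZeroDivisors (a ⊕ b) u (begin
    (a ⊕ b) · u   ≡⟨ ·-distribʳ-⊕ a b u ⟩
    a · u ⊕ b · u ≡⟨ cong (_⊕ b · u) au≡bu ⟩
    b · u ⊕ b · u ≡⟨ ⊕-self (b · u) ⟩
    0ᵛ            ∎)
  ... | inj₁ a⊕b≡0 = ⊕≡0ᵛ⇒≡ a⊕b≡0
  ... | inj₂ u≡0   = contradiction u≡0 u≢0

  square : Bits n → Bits n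
  square u = u · u

  square-⊕ : ∀ u v → square (u ⊕ v) ≡ square u ⊕ square v
  square-⊕ u v = begin
    (u ⊕ v) · (u ⊕ v)                   ≡⟨ ·-distribʳ-⊕ u v (u ⊕ v) ⟩
    u · (u ⊕ v) ⊕ v · (u ⊕ v)           ≡⟨ cong₂ _⊕_ (·-distribˡ-⊕ u u v) (·-distribˡ-⊕ v u v) ⟩
    u · u ⊕ u · v ⊕ (v · u ⊕ v · v)     ≡⟨ cong (λ x → u · u ⊕ u · v ⊕ (x ⊕ v · v)) (·-comm v u) ⟩
    u · u ⊕ u · v ⊕ (u · v ⊕ v · v)     ≡⟨ solve 3 (λ x y z → x :+ y :+ (y :+ z) := x :+ z)
                                              refl (u · u) (u · v) (v · v) ⟩
    u · u ⊕ v · v                       ∎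

  square-injective : Injective _≡_ _≡_ square
  square-injective {u} {v} uu≡vv = ⊕≡0ᵛ⇒≡ (reduce (·-noZeroDivisors (u ⊕ v) (u ⊕ v) (begin
    square (u ⊕ v)            ≡⟨ square-⊕ u v ⟩
    square u ⊕ square v       ≡⟨ cong (_⊕ square v) uu≡vv ⟩
    square v ⊕ square v       ≡⟨ ⊕-self (square v) ⟩
    0ᵛ                        ∎)))

  √ : Bits n → Bits n
  √ y = proj₁ (bits-injective⇒surjective square square-injective y)

  square-√ : ∀ y → square (√ y) ≡ y
  square-√ y = proj₂ (bits-injective⇒surjective square square-injective y)

  √-square : ∀ u → √ (square u) ≡ u
  √-square u = square-injective (square-√ (square u))

  √-⊕ : ∀ a b → √ (a ⊕ b) ≡ √ a ⊕ √ b
  √-⊕ a b = square-injective (begin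
    square (√ (a ⊕ b))          ≡⟨ square-√ (a ⊕ b) ⟩
    a ⊕ b                       ≡⟨ sym (cong₂ _⊕_ (square-√ a) (square-√ b)) ⟩
    square (√ a) ⊕ square (√ b) ≡⟨ sym (square-⊕ (√ a) (√ b)) ⟩
    square (√ a ⊕ √ b)          ∎)

  -- The term a ∧ b cancels the carry of subtraction in ℤ₄ⁿ (see DifferenceSurjective), leaving
  -- b ↦ √ (b · u), a bijection for u ≢ 0; γ stays alternating since √ (u · u) = u = u ∧ u.
  γ : Bits n → Bits n → Bits n
  γ a b = √ (a · b) ⊕ a ∧ᵛ b

  γ-additive : ∀ a b c → γ (a ⊕ b) c ≡ γ a c ⊕ γ b c
  γ-additive a b c = begin
    √ ((a ⊕ b) · c) ⊕ (a ⊕ b) ∧ᵛ c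
      ≡⟨ cong (λ x → √ x ⊕ (a ⊕ b) ∧ᵛ c) (·-distribʳ-⊕ a b c) ⟩
    √ (a · c ⊕ b · c) ⊕ (a ⊕ b) ∧ᵛ c
      ≡⟨ cong (_⊕ (a ⊕ b) ∧ᵛ c) (√-⊕ (a · c) (b · c)) ⟩
    √ (a · c) ⊕ √ (b · c) ⊕ (a ⊕ b) ∧ᵛ c
      ≡⟨ solve 5 (λ a b c s t → s :+ t :+ (a :+ b) :* c := s :+ a :* c :+ (t :+ b :* c))
           refl a b c (√ (a · c)) (√ (b · c)) ⟩
    γ a c ⊕ γ b c ∎

  γ-symmetric : ∀ a b → γ a b ≡ γ b a
  γ-symmetric a b = cong₂ _⊕_ (cong √ (·-comm a b)) (solve 2 (λ a b → a :* b := b :* a) refl a b)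

  γ-alternating : ∀ u → γ u u ≡ 0ᵛ
  γ-alternating u = trans (cong₂ _⊕_ (√-square u) (∧ᵛ-idem u)) (⊕-self u)

  f-with-polar : Σ[ f ∈ (Bits n → Bits n) ] ∀ a b → f (a ⊕ b) ≡ f a ⊕ f b ⊕ γ a b
  f-with-polar = alternating⇒polar-form n γ γ-additive γ-symmetric γ-alternating

  f : Bits n → Bits n
  f = proj₁ f-with-polar

  f-polar : ∀ a b → f (a ⊕ b) ≡ f a ⊕ f b ⊕ γ a b
  f-polar = proj₂ f-with-polar

  f-differenceSurjective : DifferenceSurjective f
  f-differenceSurjective u u≢0 v = b , (begin
    b ∧ᵛ u ⊕ (f (b ⊕ u) ⊕ f b)
      ≡⟨ cong (λ x → b ∧ᵛ u ⊕ (x ⊕ f b)) (f-polar b u) ⟩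
    b ∧ᵛ u ⊕ (f b ⊕ f u ⊕ (√ (b · u) ⊕ b ∧ᵛ u) ⊕ f b)
      ≡⟨ solve 5 (λ b u s x y → b :* u :+ (x :+ y :+ (s :+ b :* u) :+ x) := y :+ s)
           refl b u (√ (b · u)) (f b) (f u) ⟩
    f u ⊕ √ (b · u)
      ≡⟨ cong (λ x → f u ⊕ √ x) bu≡ ⟩
    f u ⊕ √ (square (v ⊕ f u))
      ≡⟨ cong (f u ⊕_) (√-square (v ⊕ f u)) ⟩
    f u ⊕ (v ⊕ f u)
      ≡⟨ solve 2 (λ v y → y :+ (v :+ y) := v) refl v (f u) ⟩
    v ∎)
    where
    b-with : ∃[ b ] b · u ≡ square (v ⊕ f u)
    b-with = bits-injective⇒surjective (_· u) (·-cancelʳ u≢0) (square (v ⊕ f u))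
    b = proj₁ b-with
    bu≡ = proj₂ b-with

-- ℤ₄ⁿ as pairs of bit vectors

-- embed a p = a + 2 p
embed : Bool → Bool → Z4
embed false false = zero
embed true  false = suc zero
embed false true  = suc (suc zero)
embed true  true  = suc (suc (suc zero))

low high : Z4 → Bool
low zero                   = false
low (suc zero)             = true
low (suc (suc zero))       = false
low (suc (suc (suc zero))) = true
high zero                   = false
high (suc zero)             = false
high (suc (suc zero))       = true
high (suc (suc (suc zero))) = true

embed-low-high : ∀ x → embed (low x) (high x) ≡ x
embed-low-high zero                   = refl
embed-low-high (suc zero)             = refl
embed-low-high (suc (suc zero))       = refl
embed-low-high (suc (suc (suc zero))) = refl

-- The borrow out of the low bit of (a + 2 p) − (b + 2 q) is b ∧ ¬ a = b ∧ (a xor b).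
embed-difference : ∀ a p b q → embed a p -₄ embed b q ≡ embed (a xor b) (b ∧ (a xor b) xor (p xor q))
embed-difference false false false false = refl
embed-difference false false false true  = refl
embed-difference false false true  false = refl
embed-difference false false true  true  = refl
embed-difference false true  false false = refl
embed-difference false true  false true  = refl
embed-difference false true  true  false = refl
embed-difference false true  true  true  = refl
embed-difference true  false false false = refl
embed-difference true  false false true  = refl
embed-difference true  false true  false = refl
embed-difference true  false true  true  = refl
embed-difference true  true  false false = refl
embed-difference true  true  false true  = refl
embed-difference true  true  true  false = refl
embed-difference true  true  true  true  = refl

embedᵛ : ∀ {n} → Bits n → Bits n → Z4^ n
embedᵛ = zipWith embed

lowᵛ highᵛ : ∀ {n} → Z4^ n → Bits n
lowᵛ  = Vec.map low
highᵛ = Vec.map high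

embedᵛ-lowᵛ-highᵛ : ∀ {n} (x : Z4^ n) → embedᵛ (lowᵛ x) (highᵛ x) ≡ x
embedᵛ-lowᵛ-highᵛ []      = refl
embedᵛ-lowᵛ-highᵛ (x ∷ v) = cong₂ _∷_ (embed-low-high x) (embedᵛ-lowᵛ-highᵛ v)

embedᵛ-difference : ∀ {n} (a p b q : Bits n) →
  embedᵛ a p -ᵥ embedᵛ b q ≡ embedᵛ (a ⊕ b) (b ∧ᵛ (a ⊕ b) ⊕ (p ⊕ q))
embedᵛ-difference []      []      []      []      = refl
embedᵛ-difference (a ∷ v) (p ∷ s) (b ∷ w) (q ∷ t) =
  cong₂ _∷_ (embed-difference a p b q) (embedᵛ-difference v s w t)

graph : ∀ {n} → (Bits n → Bits n) → List (Z4^ n)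
graph {n} f = map (λ a → embedᵛ a (f a)) (vectors n)

graph-differences : ∀ {n} (f : Bits n → Bits n) → DifferenceSurjective f →
  ∀ x → lowᵛ x ≢ 0ᵛ → ∃[ a ] ∃[ b ] (a ∈ graph f × b ∈ graph f × x ≡ a -ᵥ b)
graph-differences {n} f carry-surjective x u≢0 =
  let b , b≡ = carry-surjective (lowᵛ x) u≢0 (highᵛ x) in
  embedᵛ (b ⊕ lowᵛ x) (f (b ⊕ lowᵛ x)) , embedᵛ b (f b) ,
  ∈-map⁺ _ (∈-vectors (b ⊕ lowᵛ x)) , ∈-map⁺ _ (∈-vectors b) , sym (begin
    embedᵛ (b ⊕ u) (f (b ⊕ u)) -ᵥ embedᵛ b (f b)
      ≡⟨ embedᵛ-difference (b ⊕ u) _ b _ ⟩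
    embedᵛ (b ⊕ u ⊕ b) (b ∧ᵛ (b ⊕ u ⊕ b) ⊕ (f (b ⊕ u) ⊕ f b))
      ≡⟨ cong (λ a → embedᵛ a (b ∧ᵛ a ⊕ (f (b ⊕ u) ⊕ f b))) (solve 2 (λ b u → b :+ u :+ b := u) refl b u) ⟩
    embedᵛ u (b ∧ᵛ u ⊕ (f (b ⊕ u) ⊕ f b))
      ≡⟨ cong (embedᵛ u) b≡ ⟩
    embedᵛ u (highᵛ x)
      ≡⟨ embedᵛ-lowᵛ-highᵛ x ⟩
    x ∎)
  where
  open ≡-Reasoning
  open BitsSolver {n}
  u = lowᵛ x

-- The subgroup 2 ℤ₄ⁿ ≅ 𝔽₂ⁿ is covered by differences of the two coordinate halves.
patches : ∀ k m → List (Z4^ (k + m))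
patches k m = map (λ w → embedᵛ 0ᵛ (w ++ᵛ 0ᵛ)) (vectors k) ++ map (λ w → embedᵛ 0ᵛ (0ᵛ ++ᵛ w)) (vectors m)

length-patches : ∀ k m → length (patches k m) ≡ 2 ^ k + 2 ^ m
length-patches k m = trans (length-++ (map _ (vectors k))) (cong₂ _+_
  (trans (length-map _ (vectors k)) (length-vectors k)) (trans (length-map _ (vectors m)) (length-vectors m)))

patch-differences : ∀ k m (x : Z4^ (k + m)) → lowᵛ x ≡ 0ᵛ →
  ∃[ a ] ∃[ b ] (a ∈ patches k m × b ∈ patches k m × x ≡ a -ᵥ b)
patch-differences k m x low≡0 with splitAt k (highᵛ x)
... | v , w , high≡ =
  embedᵛ 0ᵛ (v ++ᵛ 0ᵛ) , embedᵛ 0ᵛ (0ᵛ ++ᵛ w) ,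
  ∈-++⁺ˡ (∈-map⁺ _ (∈-vectors v)) , ∈-++⁺ʳ (map _ (vectors k)) (∈-map⁺ _ (∈-vectors w)) , sym (begin
    embedᵛ 0ᵛ (v ++ᵛ 0ᵛ) -ᵥ embedᵛ 0ᵛ (0ᵛ ++ᵛ w)
      ≡⟨ embedᵛ-difference 0ᵛ _ 0ᵛ _ ⟩
    embedᵛ (0ᵛ ⊕ 0ᵛ) (0ᵛ ∧ᵛ (0ᵛ ⊕ 0ᵛ) ⊕ ((v ++ᵛ 0ᵛ) ⊕ (0ᵛ ++ᵛ w)))
      ≡⟨ cong₂ embedᵛ (⊕-self 0ᵛ) (trans
           (solve 2 (λ s t → con false :* (con false :+ con false) :+ (s :+ t) := s :+ t) refl _ _)
           (halves v w)) ⟩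
    embedᵛ 0ᵛ (v ++ᵛ w)
      ≡⟨ cong₂ embedᵛ (sym low≡0) (sym high≡) ⟩
    embedᵛ (lowᵛ x) (highᵛ x)
      ≡⟨ embedᵛ-lowᵛ-highᵛ x ⟩
    x ∎)
  where
  open ≡-Reasoning
  open BitsSolver {k + m}
  halves : ∀ {k m} (v : Bits k) (w : Bits m) → (v ++ᵛ 0ᵛ) ⊕ (0ᵛ ++ᵛ w) ≡ v ++ᵛ w
  halves []      w = ⊕-identityˡ w
  halves (a ∷ v) w = cong₂ _∷_ (Boolₚ.xor-identityʳ a) (halves v w)

belowBound-≤ : ∀ {n L P} → L ≤ 2 ^ n + P → P * P ≤ 9 * 2 ^ n → BelowBound n L
belowBound-≤ {n} {L} {P} L≤ P²≤ = ≤-trans (*-mono-≤ L∸2ⁿ≤P L∸2ⁿ≤P) P²≤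
  where
  L∸2ⁿ≤P : L ∸ 2 ^ n ≤ P
  L∸2ⁿ≤P = ≤-trans (∸-monoˡ-≤ (2 ^ n) L≤) (≤-reflexive (m+n∸m≡n (2 ^ n) P))

halves-bound : ∀ n → (2 ^ ⌊ n /2⌋ + 2 ^ ⌈ n /2⌉) * (2 ^ ⌊ n /2⌋ + 2 ^ ⌈ n /2⌉) ≤ 9 * 2 ^ n
halves-bound zero          = m≤m+n 4 5
halves-bound (suc zero)    = m≤m+n 9 9
halves-bound (suc (suc n)) = begin
  (2 * x + 2 * y) * (2 * x + 2 * y)
    ≡⟨ solve 2 (λ x y → (con 2 :* x :+ con 2 :* y) :* (con 2 :* x :+ con 2 :* y) := con 4 :* ((x :+ y) :* (x :+ y)))
         refl x y ⟩
  4 * ((x + y) * (x + y))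
    ≤⟨ *-monoʳ-≤ 4 (halves-bound n) ⟩
  4 * (9 * 2 ^ n)
    ≡⟨ solve 1 (λ p → con 4 :* (con 9 :* p) := con 9 :* (con 2 :* (con 2 :* p))) refl (2 ^ n) ⟩
  9 * 2 ^ suc (suc n) ∎
  where
  open ≤-Reasoning
  open +-*-Solver
  x = 2 ^ ⌊ n /2⌋
  y = 2 ^ ⌈ n /2⌉

graph-patches-differenceBasis : ∀ k m (f : Bits (k + m) → Bits (k + m)) → DifferenceSurjective f →
  IsDiffBasis (k + m) (graph f ++ patches k m)
graph-patches-differenceBasis k m f f-surjective x = cover (lowᵛ x ≟ᵛ 0ᵛ)
  where
  A = graph f ++ patches k m
  cover : Dec (lowᵛ x ≡ 0ᵛ) → ∃[ a ] ∃[ b ] (a ∈ A × b ∈ A × x ≡ a -ᵥ b)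
  cover (yes low≡0) = let a , b , a∈ , b∈ , x≡ = patch-differences k m x low≡0 in
                      a , b , ∈-++⁺ʳ (graph f) a∈ , ∈-++⁺ʳ (graph f) b∈ , x≡
  cover (no  low≢0) = let a , b , a∈ , b∈ , x≡ = graph-differences f f-surjective x low≢0 in
                      a , b , ∈-++⁺ˡ a∈ , ∈-++⁺ˡ b∈ , x≡

difference-basis : ∀ k m (f : Bits (k + m) → Bits (k + m)) → DifferenceSurjective f →
  (2 ^ k + 2 ^ m) * (2 ^ k + 2 ^ m) ≤ 9 * 2 ^ (k + m) →
  ∃[ A ] (Unique A × IsDiffBasis (k + m) A × BelowBound (k + m) (length A))
difference-basis k m f f-surjective bound =
  deduplicate _≟ᶻ_ candidates , deduplicate-! _≟ᶻ_ candidates ,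
  (λ x → let a , b , a∈ , b∈ , x≡ = graph-patches-differenceBasis k m f f-surjective x in
    a , b , ∈-deduplicate⁺ _≟ᶻ_ a∈ , ∈-deduplicate⁺ _≟ᶻ_ b∈ , x≡) ,
  belowBound-≤ {k + m} (≤-trans (length-deduplicate _≟ᶻ_ candidates) (≤-reflexive length-candidates)) bound
  where
  _≟ᶻ_ : DecidableEquality (Z4^ (k + m))
  _≟ᶻ_ = Vecₚ.≡-dec Fin._≟_
  candidates : List (Z4^ (k + m))
  candidates = graph f ++ patches k m
  length-candidates : length candidates ≡ 2 ^ (k + m) + (2 ^ k + 2 ^ m)
  length-candidates = trans (length-++ (graph f))
    (cong₂ _+_ (trans (length-map _ (vectors (k + m))) (length-vectors (k + m))) (length-patches k m))

lemma3p7 : ∀ (n : ℕ) → n ≥ 1 →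
    ∃[ A ] (Unique A × IsDiffBasis n A × BelowBound n (length A))
lemma3p7 n n≥1 = subst (λ n → ∃[ A ] (Unique A × IsDiffBasis n A × BelowBound n (length A))) k+m≡n
  (difference-basis k m f f-differenceSurjective
    (subst (λ e → (2 ^ k + 2 ^ m) * (2 ^ k + 2 ^ m) ≤ 9 * 2 ^ e) (sym k+m≡n) (halves-bound n)))
  where
  k = ⌊ n /2⌋
  m = ⌈ n /2⌉
  k+m≡n : k + m ≡ n
  k+m≡n = ⌊n/2⌋+⌈n/2⌉≡n n
  open QuadraticMap (nonsingularProduct (k + m) (subst (1 ≤_) (sym k+m≡n) n≥1))
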